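{- Let $c,d\in\mathbb N$ with $c\ge1$. For every satisfiable $\mathrm{FO}+\mathrm{MOD}$ sentence $\phi$ there exist $k\in\mathbb N$ and a finite set $X$ of $k$-capped component histogram vectors such that $$P_\phi\cap\mathcal C^c_d=\{G\in\mathcal C^c_d \mid G \text{ satisfies } \bar a \text{ for some } \bar a\in X\},$$ where $P_\phi$ is the class of finite graphs satisfying $\phi$.
   Context: Graphs are finite, simple, undirected. $\mathcal C^c_d$ is the class of graphs of maximum degree $\le d$ all of whose connected components have at most $c$ vertices. $\mathrm{FO}+\mathrm{MOD}$ is first-order logic over the edge relation extended by modular counting quantifiers $\exists^{j(\mathrm{mod}\ \ell)}x$. Let $T_{\mathrm{comp}}(c,d)=\{t_1,\dots,t_M\}$ be the finite set of isomorphism types of connected graphs with at most $c$ vertices and maximum degree $\le d$. The component histogram vector $\mathrm{chv}_c(G)$ of $G\in\mathcal C^c_d$ is the vector of length $M$ whose $i$-th entry is the number of connected components of $G$ isomorphic to $t_i$. For $k\in\mathbb N$, a $k$-capped component histogram vector is a vector $\bar a$ of length $M$ with entries in $\{0,1,\dots,k-1\}\cup\{(j,\ell)\mid j,\ell\in\mathbb N,\ j<\ell\}$. A graph $G\in\mathcal C^c_d$ satisfies $\bar a$ if for every $i\in\{1,\dots,M\}$ either $\bar a[i]=\mathrm{chv}_c(G)[i]$, or $\bar a[i]=(j,\ell)$, $\mathrm{chv}_c(G)[i]\ge k$ and $\mathrm{chv}_c(G)[i]\equiv j \pmod{\ell}$. -}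

module Defs where

open import Data.Nat using (ℕ; zero; suc; _+_; _*_; _≤_; _<_; _%_)
open import Data.Nat using (_≡ᵇ_)
open import Data.Bool using (Bool; true; false; not; _∧_; _∨_)
open import Data.Fin using (Fin; toℕ)
import Data.Fin as Fin
open import Data.List using (List; length; map; filterᵇ)
open import Data.Bool.ListAction using (any)
open import Data.Unit using (⊤)
open import Data.List.Relation.Unary.Any using (Any)
open import Data.List.Base using (allFin)
open import Data.Product using (Σ; ∃; _×_; _,_)
open import Relation.Binary.PropositionalEquality using (_≡_)
open import Relation.Nullary using (¬_)
open import Relation.Nullary.Decidable using (⌊_⌋)
open import Function.Definitions using (Injective; Surjective)

record Graph : Set where
  field
    n      : ℕ
    adj    : Fin n → Fin n → Bool
    sym    : ∀ i j → adj i j ≡ adj j i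
    irrefl : ∀ i → adj i i ≡ false
open Graph public

degree : (G : Graph) → Fin (n G) → ℕ
degree G v = length (filterᵇ (adj G v) (allFin (n G)))

MaxDeg≤ : Graph → ℕ → Set
MaxDeg≤ G d = ∀ v → degree G v ≤ d

data Reach (G : Graph) : Fin (n G) → Fin (n G) → Set where
  here : ∀ {u} → Reach G u u
  step : ∀ {u w v} → adj G u w ≡ true → Reach G w v → Reach G u v

CountIs : {N : ℕ} → (Fin N → Set) → ℕ → Set
CountIs {N} P m =
  Σ (Fin m → Fin N) λ f →
    Injective _≡_ _≡_ f × (∀ i → P (f i)) × (∀ v → P v → ∃ λ i → f i ≡ v)

CompsAtMost : Graph → ℕ → Set
CompsAtMost G c = ∀ v (f : Fin (suc c) → Fin (n G)) →
  Injective _≡_ _≡_ f → ¬ (∀ i → Reach G v (f i))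

InClass : ℕ → ℕ → Graph → Set
InClass c d G = MaxDeg≤ G d × CompsAtMost G c

Connected : Graph → Set
Connected G = Fin (n G) × (∀ u v → Reach G u v)

_≅_ : Graph → Graph → Set
H ≅ H' = Σ (Fin (n H) → Fin (n H')) λ f →
  Injective _≡_ _≡_ f × Surjective _≡_ _≡_ f × (∀ i j → adj H' (f i) (f j) ≡ adj H i j)

-- connected graphs with ≤ c vertices and max degree ≤ d
-- (the isomorphism types of these form T_comp(c,d))
record CompGraph (c d : ℕ) : Set where
  field
    graph     : Graph
    connected : Connected graph
    small     : n graph ≤ c
    degBound  : MaxDeg≤ graph d
open CompGraph public

CompIso : (G : Graph) → Fin (n G) → Graph → Set
CompIso G v H = Σ (Fin (n H) → Fin (n G)) λ f →
  Injective _≡_ _≡_ f × (∀ i → Reach G v (f i)) × (∀ u → Reach G v u → ∃ λ i → f i ≡ u)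
  × (∀ i j → adj G (f i) (f j) ≡ adj H i j)

IsRep : (G : Graph) → Fin (n G) → Set
IsRep G v = ∀ u → Reach G u v → toℕ v ≤ toℕ u

ChvIs : Graph → Graph → ℕ → Set
ChvIs G H m = CountIs (λ v → IsRep G v × CompIso G v H) m

data Entry : Set where
  exact : ℕ → Entry
  modc  : (j ℓ : ℕ) → j < ℓ → Entry

CappedEntry : ℕ → Entry → Set
CappedEntry k (exact e)    = e < k
CappedEntry k (modc j ℓ _) = ⊤

-- a k-capped vector indexed by isomorphism types: a function on
-- representatives that is invariant under isomorphism
record CappedVec (c d k : ℕ) : Set where
  field
    entry  : CompGraph c d → Entry
    invar  : ∀ H H' → graph H ≅ graph H' → entry H ≡ entry H'
    capped : ∀ H → CappedEntry k (entry H)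
open CappedVec public

EntryOK : ℕ → Entry → ℕ → Set
EntryOK k (exact e)    m = e ≡ m
EntryOK k (modc j ℓ _) m = k ≤ m × ∃ λ q → m ≡ j + q * ℓ

SatisfiesVec : ∀ {c d k} → Graph → CappedVec c d k → Set
SatisfiesVec {k = k} G a =
  ∀ H m → ChvIs G (graph H) m → EntryOK k (entry a H) m

-- FO+MOD over the edge relation (de Bruijn variables)

data Formula : ℕ → Set where
  edge : ∀ {m} → Fin m → Fin m → Formula m
  eq   : ∀ {m} → Fin m → Fin m → Formula m
  neg  : ∀ {m} → Formula m → Formula m
  and  : ∀ {m} → Formula m → Formula m → Formula m
  or   : ∀ {m} → Formula m → Formula m → Formula m
  ex   : ∀ {m} → Formula (suc m) → Formula m
  all  : ∀ {m} → Formula (suc m) → Formula m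
  -- ∃^{j (mod ℓ)} x φ : number of x with φ is ≡ j mod ℓ
  exmod : ∀ {m} (j ℓ : ℕ) → j < ℓ → Formula (suc m) → Formula m

extend : ∀ {m N} → Fin N → (Fin m → Fin N) → Fin (suc m) → Fin N
extend x ρ Fin.zero    = x
extend x ρ (Fin.suc i) = ρ i

countTrue : List Bool → ℕ
countTrue bs = length (filterᵇ (λ b → b) bs)

eval : (G : Graph) → ∀ {m} → Formula m → (Fin m → Fin (n G)) → Bool
eval G (edge x y) ρ = adj G (ρ x) (ρ y)
eval G (eq x y)   ρ = ⌊ ρ x Fin.≟ ρ y ⌋
eval G (neg φ)    ρ = not (eval G φ ρ)
eval G (and φ ψ)  ρ = eval G φ ρ ∧ eval G ψ ρ
eval G (or φ ψ)   ρ = eval G φ ρ ∨ eval G ψ ρ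
eval G (ex φ)     ρ = any (λ x → eval G φ (extend x ρ)) (allFin (n G))
eval G (all φ)    ρ = not (any (λ x → not (eval G φ (extend x ρ))) (allFin (n G)))
eval G (exmod j (suc ℓ) _ φ) ρ =
  (countTrue (map (λ x → eval G φ (extend x ρ)) (allFin (n G))) % suc ℓ) ≡ᵇ j

Sentence : Set
Sentence = Formula 0

_⊨_ : Graph → Sentence → Set
G ⊨ φ = eval G φ (λ ()) ≡ true

Satisfiable : Sentence → Set
Satisfiable φ = ∃ λ G → G ⊨ φ

{-# OPTIONS --safe #-}
-- A graph in C^c_d is, up to isomorphism, the disjoint union of its components, each of
-- which is isomorphic to a graph of a fixed finite catalogue of graphs with at most c
-- vertices; so G is described by the histogram counting its components of each type.
-- On such a description φ can be evaluated abstractly: a quantified variable either falls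
-- into one of the finitely many components already holding a variable, or into a fresh
-- component of some type i, whose count is then decremented; a counting quantifier adds
-- (count of type i) × (witnesses inside one fresh component of type i).  By induction on φ
-- this value depends on each count only up to the threshold rank φ and, above it, modulo
-- period φ.  Hence G ⊨ φ is decided by the capped histogram of G, and X consists of the
-- capped histograms whose canonical representatives satisfy φ.
module Submission where

open import Defs renaming (sym to adj-sym)

open import Data.Bool using (Bool; true; false; not; _∧_; _∨_; T; if_then_else_)
import Data.Bool as Bool
open import Data.Bool.ListAction as ListAction using (any)
open import Data.Bool.Properties using (∨-comm; ∨-assoc; ∨-identityʳ; T-∧; ¬-not)
open import Data.Empty using (⊥; ⊥-elim)
open import Data.Fin using (Fin; zero; suc; toℕ; inject≤; fromℕ<)
open import Data.Fin.Properties using (injective⇒≤; inject≤-injective; toℕ-injective; toℕ<n; toℕ-fromℕ<; _≟_; any?; all?; _<?_; <-cmp; <-irrefl)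
open import Data.List using (List; []; _∷_; length; map; _++_; filter; filterᵇ; allFin; lookup; concatMap; upTo)
open import Data.List.Membership.Propositional using (_∈_; find; lose)
open import Data.List.Membership.Propositional.Properties using (∈-lookup; ∈-allFin; ∈-map⁺; ∈-map⁻; ∈-upTo⁺; ∈-upTo⁻; ∈-concatMap⁻; ∈-++⁺ˡ; ∈-++⁺ʳ; ∈-filter⁺; ∈-filter⁻)
open import Data.List.Membership.Propositional.Properties.WithK using (unique∧set⇒bag)
open import Data.List.Properties using (length-++; filter-++; map-∘; map-cong; map-id; map-++; ++-assoc; length-tabulate; filter-none)
open import Data.List.Relation.Binary.BagAndSetEquality using (∼bag⇒↭)
open import Data.List.Relation.Binary.Permutation.Propositional using (_↭_; ↭-sym)
open import Data.List.Relation.Binary.Permutation.Propositional.Properties using (↭-length; filter-↭; Any-resp-↭)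
open import Data.List.Relation.Unary.All as All using (All; _∷_)
open import Data.List.Relation.Unary.All.Properties.Core using (¬Any⇒All¬)
open import Data.List.Relation.Unary.AllPairs using ([]; _∷_)
open import Data.List.Relation.Unary.Any as Any using (Any; here; there; index)
open import Data.List.Relation.Unary.Any.Properties using (any⁺; any⁻; lookup-index)
import Data.List.Relation.Unary.Any.Properties as AnyP
open import Data.List.Relation.Unary.Unique.Propositional using (Unique)
import Data.List.Relation.Unary.Unique.Propositional.Properties as UP
open import Data.Maybe using (Maybe; just; nothing; fromMaybe)
import Data.Maybe as Maybe
open import Data.Nat using (ℕ; zero; suc; _+_; _*_; _∸_; _%_; _⊔_; _≤_; _<_; _<ᵇ_; _≡ᵇ_; z≤n; s≤s; _≤?_; NonZero; >-nonZero)
open import Data.Nat.DivMod using (_/_; [m+kn]%n≡m%n; %-distribˡ-+; m≡m%n+[m/n]*n; m%n<n)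
open import Data.Nat.Divisibility using (_∣_; divides; m∣m*n; n∣m*n)
open import Data.Nat.Properties using (≤-antisym; ≤-trans; <⇒≤; n<1+n; suc-injective; suc-pred; ≰⇒>; ≮⇒≥; m≤m*n; m≤n+m; <⇒<ᵇ; <ᵇ⇒<; +-assoc; *-assoc; n≤1+n; m≤m⊔n; m≤n⊔m; m*n≢0; +-0-commutativeMonoid; module ≤-Reasoning)
  renaming (_<?_ to _<ℕ?_)
open import Algebra.Properties.CommutativeMonoid.Sum +-0-commutativeMonoid using (sum; sum-cong-≗; sum-replicate-zero)
open import Data.Nat.Solver using (module +-*-Solver)
open +-*-Solver using (solve; _:=_; _:+_; _:*_)
open import Data.Product using (Σ; ∃; _×_; _,_; proj₁; proj₂)
open import Data.Sum using (_⊎_; inj₁; inj₂)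
open import Data.Sum.Properties using (≡-dec; inj₁-injective; inj₂-injective)
open import Function using (id; _∘_; _⇔_; mk⇔; Equivalence)
open import Function.Definitions using (Injective; Surjective)
open import Relation.Binary using (tri<; tri≈; tri>; DecidableEquality)
open import Relation.Binary.PropositionalEquality using (_≡_; refl; sym; trans; cong; cong₂; subst; subst₂; module ≡-Reasoning)
open import Relation.Nullary using (¬_; Dec; yes; no; does)
open import Relation.Nullary.Decidable using (⌊_⌋; map′; _×-dec_; _→-dec_; dec-true; dec-false)
open import Relation.Unary using (Decidable)

private variable
  A B : Set

-- Counting and searching in lists

countᵇ : (A → Bool) → List A → ℕ
countᵇ p xs = length (filterᵇ p xs)

countᵇ-++ : ∀ (p : A → Bool) xs ys → countᵇ p (xs ++ ys) ≡ countᵇ p xs + countᵇ p ys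
countᵇ-++ p xs ys = trans (cong length (filter-++ _ xs ys)) (length-++ (filterᵇ p xs))

countᵇ-map : ∀ (p : B → Bool) (f : A → B) xs → countᵇ p (map f xs) ≡ countᵇ (p ∘ f) xs
countᵇ-map p f [] = refl
countᵇ-map p f (x ∷ xs) with p (f x)
... | true  = cong suc (countᵇ-map p f xs)
... | false = countᵇ-map p f xs

countᵇ-cong : ∀ {p q : A → Bool} xs → (∀ x → p x ≡ q x) → countᵇ p xs ≡ countᵇ q xs
countᵇ-cong [] p≗q = refl
countᵇ-cong {p = p} {q = q} (x ∷ xs) p≗q with p x | q x | p≗q x
... | true  | true  | refl = cong suc (countᵇ-cong xs p≗q)
... | false | false | refl = countᵇ-cong xs p≗q

countᵇ-↭ : ∀ (p : A → Bool) {xs ys} → xs ↭ ys → countᵇ p xs ≡ countᵇ p ys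
countᵇ-↭ p xs↭ys = ↭-length (filter-↭ _ xs↭ys)

countTrue-map : ∀ (p : A → Bool) xs → countTrue (map p xs) ≡ countᵇ p xs
countTrue-map p = countᵇ-map id p

T-ext : ∀ {a b : Bool} → (T a → T b) → (T b → T a) → a ≡ b
T-ext {false} {false} _ _ = refl
T-ext {false} {true}  _ g = ⊥-elim (g _)
T-ext {true}  {false} f _ = ⊥-elim (f _)
T-ext {true}  {true}  _ _ = refl

any-↭ : ∀ (p : A → Bool) {xs ys} → xs ↭ ys → any p xs ≡ any p ys
any-↭ p xs↭ys = T-ext (any⁺ p ∘ Any-resp-↭ xs↭ys ∘ any⁻ p _)
                      (any⁺ p ∘ Any-resp-↭ (↭-sym xs↭ys) ∘ any⁻ p _)

any-++ : ∀ (p : A → Bool) xs ys → any p (xs ++ ys) ≡ any p xs ∨ any p ys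
any-++ p []       ys = refl
any-++ p (x ∷ xs) ys = trans (cong (p x ∨_) (any-++ p xs ys)) (sym (∨-assoc (p x) _ _))

any-map : ∀ (p : B → Bool) (f : A → B) xs → any p (map f xs) ≡ any (p ∘ f) xs
any-map p f xs = cong ListAction.or (sym (map-∘ xs))

any-cong : ∀ {p q : A → Bool} xs → (∀ x → p x ≡ q x) → any p xs ≡ any q xs
any-cong xs p≗q = cong ListAction.or (map-cong p≗q xs)

lookup-injective : ∀ {xs : List A} → Unique xs → ∀ {i j} → lookup xs i ≡ lookup xs j → i ≡ j
lookup-injective {xs = x ∷ xs} (x∉xs ∷ u) {zero}  {zero}  _ = refl
lookup-injective {xs = x ∷ xs} (x∉xs ∷ u) {zero}  {suc j} e = ⊥-elim (All.lookup x∉xs (∈-lookup j) e)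
lookup-injective {xs = x ∷ xs} (x∉xs ∷ u) {suc i} {zero}  e = ⊥-elim (All.lookup x∉xs (∈-lookup i) (sym e))
lookup-injective {xs = x ∷ xs} (x∉xs ∷ u) {suc i} {suc j} e = cong suc (lookup-injective u e)

lookup-index∈ : ∀ {xs : List A} {x} (x∈xs : x ∈ xs) → lookup xs (index x∈xs) ≡ x
lookup-index∈ x∈xs = sym (lookup-index x∈xs)

Unique-⊆⇒length≤ : ∀ {xs ys : List A} → Unique xs → (∀ {x} → x ∈ xs → x ∈ ys) → length xs ≤ length ys
Unique-⊆⇒length≤ {xs = xs} {ys} u xs⊆ys = injective⇒≤ position-injective
  where
  open ≡-Reasoning
  position : Fin (length xs) → Fin (length ys)
  position i = index (xs⊆ys (∈-lookup i))
  position-injective : Injective _≡_ _≡_ position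
  position-injective {i} {j} e = lookup-injective u (begin
    lookup xs i                                ≡⟨ lookup-index∈ (xs⊆ys (∈-lookup i)) ⟨
    lookup ys (position i)                     ≡⟨ cong (lookup ys) e ⟩
    lookup ys (position j)                     ≡⟨ lookup-index∈ (xs⊆ys (∈-lookup j)) ⟩
    lookup xs j                                ∎)

Unique-≐⇒↭ : ∀ {xs ys : List A} → Unique xs → Unique ys →
             (∀ {x} → x ∈ xs → x ∈ ys) → (∀ {x} → x ∈ ys → x ∈ xs) → xs ↭ ys
Unique-≐⇒↭ uxs uys xs⊆ys ys⊆xs = ∼bag⇒↭ (unique∧set⇒bag uxs uys (mk⇔ xs⊆ys ys⊆xs))

countᵇ-Unique-⊆ : ∀ (p : A → Bool) {xs ys} → Unique xs → (∀ {x} → x ∈ xs → x ∈ ys) → countᵇ p xs ≤ countᵇ p ys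
countᵇ-Unique-⊆ p unique-xs xs⊆ys = Unique-⊆⇒length≤ (UP.filter⁺ _ unique-xs) λ x∈ →
  let (x∈xs , px) = ∈-filter⁻ _ x∈ in ∈-filter⁺ _ (xs⊆ys x∈xs) px

module _ {N} (f : A → Fin N) (f-injective : ∀ {x y} → f x ≡ f y → x ≡ y)
         (f-surjective : ∀ i → ∃ λ x → f x ≡ i)
         {xs : List A} (xs-unique : Unique xs) (xs-complete : ∀ x → x ∈ xs) where

  map-enumeration-↭ : map f xs ↭ allFin N
  map-enumeration-↭ = Unique-≐⇒↭ (UP.map⁺ f-injective xs-unique) (UP.allFin⁺ N)
    (λ {i} _ → ∈-allFin i)
    (λ {i} _ → let (x , fx≡i) = f-surjective i in subst (_∈ map f xs) fx≡i (∈-map⁺ f (xs-complete x)))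

  countᵇ-enumeration : ∀ (p : Fin N → Bool) → countᵇ p (allFin N) ≡ countᵇ (p ∘ f) xs
  countᵇ-enumeration p = trans (sym (countᵇ-↭ p map-enumeration-↭)) (countᵇ-map p f xs)

  any-enumeration : ∀ (p : Fin N → Bool) → any p (allFin N) ≡ any (p ∘ f) xs
  any-enumeration p = trans (sym (any-↭ p map-enumeration-↭)) (any-map p f xs)

module _ {N} {P : Fin N → Set} {ys : List (Fin N)} (ys-unique : Unique ys)
         (P⇒∈ : ∀ {v} → P v → v ∈ ys) (∈⇒P : ∀ {v} → v ∈ ys → P v) where

  CountIs-length : CountIs P (length ys)
  CountIs-length = lookup ys , lookup-injective ys-unique , (λ i → ∈⇒P (∈-lookup i)) ,
                   λ v Pv → index (P⇒∈ Pv) , lookup-index∈ (P⇒∈ Pv)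

  CountIs⇒≡length : ∀ {m} → CountIs P m → m ≡ length ys
  CountIs⇒≡length {m} (f , f-injective , f-sound , f-complete) =
    ≤-antisym (injective⇒≤ into-ys) (injective⇒≤ into-Fin-m)
    where
    open ≡-Reasoning
    into-ys : Injective _≡_ _≡_ (λ i → index (P⇒∈ (f-sound i)))
    into-ys {i} {j} e = f-injective (begin
      f i                                  ≡⟨ lookup-index∈ (P⇒∈ (f-sound i)) ⟨
      lookup ys (index (P⇒∈ (f-sound i)))  ≡⟨ cong (lookup ys) e ⟩
      lookup ys (index (P⇒∈ (f-sound j)))  ≡⟨ lookup-index∈ (P⇒∈ (f-sound j)) ⟩
      f j                                  ∎)
    preimage : ∀ t → ∃ λ i → f i ≡ lookup ys t
    preimage t = f-complete _ (∈⇒P (∈-lookup t))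
    into-Fin-m : Injective _≡_ _≡_ (λ t → proj₁ (preimage t))
    into-Fin-m {s} {t} e = lookup-injective ys-unique (begin
      lookup ys s               ≡⟨ proj₂ (preimage s) ⟨
      f (proj₁ (preimage s))    ≡⟨ cong f e ⟩
      f (proj₁ (preimage t))    ≡⟨ proj₂ (preimage t) ⟩
      lookup ys t               ∎)

least : ∀ {k} {P : Fin k → Set} → Decidable P → Maybe (Fin k)
least {zero}  P? = nothing
least {suc k} P? with P? zero
... | yes _ = just zero
... | no  _ = Maybe.map suc (least (P? ∘ suc))

least-sound : ∀ {k} {P : Fin k → Set} (P? : Decidable P) {j} → least P? ≡ just j → P j
least-sound {suc k} P? least≡j with P? zero
least-sound {suc k} P? refl | yes P₀ = P₀
... | no _ with least (P? ∘ suc) in least′≡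
least-sound {suc k} P? refl | no _ | just j = least-sound (P? ∘ suc) least′≡

least-complete : ∀ {k} {P : Fin k → Set} (P? : Decidable P) {i} → P i → ∃ λ j → least P? ≡ just j
least-complete {suc k} P? {i} Pi with P? zero
... | yes _ = zero , refl
least-complete {suc k} P? {zero}  Pi | no ¬P₀ = ⊥-elim (¬P₀ Pi)
least-complete {suc k} P? {suc i} Pi | no _ with least-complete (P? ∘ suc) Pi
... | j , least′≡j rewrite least′≡j = suc j , refl

least-minimal : ∀ {k} {P : Fin k → Set} (P? : Decidable P) {j} → least P? ≡ just j → ∀ {i} → P i → toℕ j ≤ toℕ i
least-minimal {suc k} P? least≡j Pi with P? zero
least-minimal {suc k} P? refl Pi | yes _ = z≤n
least-minimal {suc k} P? least≡j {zero}  Pi | no ¬P₀ = ⊥-elim (¬P₀ Pi)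
least-minimal {suc k} P? least≡j {suc i} Pi | no _ with least (P? ∘ suc) in least′≡
least-minimal {suc k} P? refl {suc i} Pi | no _ | just j = s≤s (least-minimal (P? ∘ suc) least′≡ Pi)

least-cong : ∀ {k} {P Q : Fin k → Set} (P? : Decidable P) (Q? : Decidable Q) →
             (∀ i → P i → Q i) → (∀ i → Q i → P i) → least P? ≡ least Q?
least-cong {zero}  P? Q? P⇒Q Q⇒P = refl
least-cong {suc k} P? Q? P⇒Q Q⇒P with P? zero | Q? zero
... | yes _  | yes _  = refl
... | yes P₀ | no ¬Q₀ = ⊥-elim (¬Q₀ (P⇒Q zero P₀))
... | no ¬P₀ | yes Q₀ = ⊥-elim (¬P₀ (Q⇒P zero Q₀))
... | no _   | no _   = cong (Maybe.map suc) (least-cong (P? ∘ suc) (Q? ∘ suc) (P⇒Q ∘ suc) (Q⇒P ∘ suc))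

-- Reachability and isomorphism

module _ (G : Graph) where

  Reach-trans : ∀ {u w v} → Reach G u w → Reach G w v → Reach G u v
  Reach-trans here         q = q
  Reach-trans (step uw p)  q = step uw (Reach-trans p q)

  Reach-sym : ∀ {u v} → Reach G u v → Reach G v u
  Reach-sym here                   = here
  Reach-sym (step {u} {w} uw p)    = Reach-trans (Reach-sym p) (step (trans (adj-sym G w u) uw) here)

  walkVertices : ∀ {u v} → Reach G u v → List (Fin (n G))
  walkVertices (here {u})     = u ∷ []
  walkVertices (step {u} _ p) = u ∷ walkVertices p

  walkLength : ∀ {u v} → Reach G u v → ℕ
  walkLength here       = 0
  walkLength (step _ p) = suc (walkLength p)

  length-walkVertices : ∀ {u v} (p : Reach G u v) → length (walkVertices p) ≡ suc (walkLength p)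
  length-walkVertices here       = refl
  length-walkVertices (step _ p) = cong suc (length-walkVertices p)

  suffixFrom : ∀ {w v x} (p : Reach G w v) → x ∈ walkVertices p →
               Σ (Reach G x v) λ q → (Unique (walkVertices p) → Unique (walkVertices q))
  suffixFrom here        (here refl)  = here , id
  suffixFrom (step uw p) (here refl)  = step uw p , id
  suffixFrom (step uw p) (there x∈p)  =
    let (q , unique-q) = suffixFrom p x∈p in q , λ { (_ ∷ unique-p) → unique-q unique-p }

  simplePath : ∀ {u v} → Reach G u v → Σ (Reach G u v) (Unique ∘ walkVertices)
  simplePath here = here , (All.[] ∷ [])
  simplePath (step {u} uw p) with simplePath p
  ... | q , unique-q with Any.any? (u ≟_) (walkVertices q)
  ...   | yes u∈q = let (r , unique-r) = suffixFrom q u∈q in r , unique-r unique-q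
  ...   | no  u∉q = step uw q , (¬Any⇒All¬ _ u∉q ∷ unique-q)

  simplePath-walkLength< : ∀ {u v} (p : Reach G u v) → Unique (walkVertices p) → walkLength p < n G
  simplePath-walkLength< p unique-p = begin-strict
    walkLength p              <⟨ n<1+n _ ⟩
    suc (walkLength p)        ≡⟨ length-walkVertices p ⟨
    length (walkVertices p)   ≤⟨ Unique-⊆⇒length≤ unique-p (λ {x} _ → ∈-allFin x) ⟩
    length (allFin (n G))     ≡⟨ length-tabulate id ⟩
    n G                       ∎
    where open ≤-Reasoning

  ReachWithin : ℕ → Fin (n G) → Fin (n G) → Set
  ReachWithin t u v = Σ (Reach G u v) λ p → walkLength p ≤ t

  reachWithin? : ∀ t u v → Dec (ReachWithin t u v)
  reachWithin? t u v with u ≟ v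
  ... | yes refl = yes (here , z≤n)
  reachWithin? zero    u v | no u≢v = no λ { (here , _) → u≢v refl ; (step _ _ , ()) }
  reachWithin? (suc t) u v | no u≢v with any? (λ w → (adj G u w Bool.≟ true) ×-dec reachWithin? t w v)
  ... | yes (w , uw , p , p≤t) = yes (step uw p , s≤s p≤t)
  ... | no ¬next = no λ { (here , _) → u≢v refl
                        ; (step uw p , s≤s p≤t) → ¬next (_ , uw , p , p≤t) }

  reach? : ∀ u v → Dec (Reach G u v)
  reach? u v = map′ proj₁ withinSize (reachWithin? (n G) u v)
    where
    withinSize : Reach G u v → ReachWithin (n G) u v
    withinSize p = let (q , unique-q) = simplePath p in q , <⇒≤ (simplePath-walkLength< q unique-q)

module _ {H H′ : Graph} where

  ≅-sym : H ≅ H′ → H′ ≅ H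
  ≅-sym (f , f-injective , f-surjective , f-adj) = g , g-injective , g-surjective , g-adj
    where
    g : Fin (n H′) → Fin (n H)
    g y = proj₁ (f-surjective y)
    f∘g : ∀ y → f (g y) ≡ y
    f∘g y = proj₂ (f-surjective y) refl
    g-injective : Injective _≡_ _≡_ g
    g-injective {a} {b} ga≡gb = trans (sym (f∘g a)) (trans (cong f ga≡gb) (f∘g b))
    g-surjective : Surjective _≡_ _≡_ g
    g-surjective x = f x , λ z≡fx → trans (cong g z≡fx) (f-injective (f∘g (f x)))
    g-adj : ∀ i j → adj H (g i) (g j) ≡ adj H′ i j
    g-adj i j = trans (sym (f-adj (g i) (g j))) (cong₂ (adj H′) (f∘g i) (f∘g j))

  ≅-trans : ∀ {H″} → H ≅ H′ → H′ ≅ H″ → H ≅ H″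
  ≅-trans (f , f-injective , f-surjective , f-adj) (g , g-injective , g-surjective , g-adj) =
    g ∘ f , f-injective ∘ g-injective ,
    (λ z → let (y , gy≡z) = g-surjective z ; (x , fx≡y) = f-surjective y
           in x , λ w≡x → trans (cong g (fx≡y w≡x)) (gy≡z refl)) ,
    λ i j → trans (g-adj (f i) (f j)) (f-adj i j)

  map-Reach : (iso : H ≅ H′) → ∀ {a b} → Reach H a b → Reach H′ (proj₁ iso a) (proj₁ iso b)
  map-Reach iso here                                = here
  map-Reach iso@(_ , _ , _ , f-adj) (step ab p)     = step (trans (f-adj _ _) ab) (map-Reach iso p)

  Connected-≅ : H ≅ H′ → Connected H → Connected H′
  Connected-≅ iso@(f , _ , f-surjective , _) (x , connected) = f x , λ u v →
    let (u₀ , fu₀≡u) = f-surjective u ; (v₀ , fv₀≡v) = f-surjective v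
    in subst₂ (Reach H′) (fu₀≡u refl) (fv₀≡v refl) (map-Reach iso (connected u₀ v₀))

  degree-≅ : (iso : H ≅ H′) → ∀ x → degree H′ (proj₁ iso x) ≡ degree H x
  degree-≅ (f , f-injective , f-surjective , f-adj) x = trans
    (countᵇ-enumeration f f-injective (λ y → proj₁ (f-surjective y) , proj₂ (f-surjective y) refl)
                        (UP.allFin⁺ _) ∈-allFin (adj H′ (f x)))
    (countᵇ-cong (allFin (n H)) (f-adj x))

  MaxDeg≤-≅ : ∀ {d} → H ≅ H′ → MaxDeg≤ H d → MaxDeg≤ H′ d
  MaxDeg≤-≅ {d} iso@(_ , _ , f-surjective , _) bounded y =
    let (x , fx≡y) = f-surjective y
    in subst (λ v → degree H′ v ≤ d) (fx≡y refl) (subst (_≤ d) (sym (degree-≅ iso x)) (bounded x))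

allFunctions : ∀ (a : ℕ) → List B → List (Fin a → B)
allFunctions zero    bs = (λ ()) ∷ []
allFunctions (suc a) bs = concatMap (λ b → map (cons b) (allFunctions a bs)) bs
  where
  cons : ∀ {B : Set} {a} → B → (Fin a → B) → Fin (suc a) → B
  cons b f zero    = b
  cons b f (suc i) = f i

allFunctions-complete : ∀ (_≈_ : B → B → Set) a (bs : List B) (h : Fin a → B) →
                        (∀ i → Any (h i ≈_) bs) → Any (λ f → ∀ i → h i ≈ f i) (allFunctions a bs)
allFunctions-complete _≈_ zero    bs h hits = here (λ ())
allFunctions-complete _≈_ (suc a) bs h hits =
  AnyP.concat⁺ (AnyP.map⁺ (Any.map (λ h₀≈b → AnyP.map⁺ (Any.map (λ h≈f → λ { zero → h₀≈b ; (suc i) → h≈f i })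
    (allFunctions-complete _≈_ a bs (h ∘ suc) (hits ∘ suc)))) (hits zero)))

IsIsomorphism : (H H′ : Graph) → (Fin (n H) → Fin (n H′)) → Set
IsIsomorphism H H′ f = Injective _≡_ _≡_ f × Surjective _≡_ _≡_ f × (∀ i j → adj H′ (f i) (f j) ≡ adj H i j)

isIsomorphism? : ∀ H H′ f → Dec (IsIsomorphism H H′ f)
isIsomorphism? H H′ f = injective? ×-dec surjective? ×-dec adj?
  where
  injective? : Dec (Injective _≡_ _≡_ f)
  injective? = map′ (λ inj {x} {y} → inj x y) (λ inj x y → inj)
    (all? λ x → all? λ y → (f x ≟ f y) →-dec (x ≟ y))
  surjective? : Dec (Surjective _≡_ _≡_ f)
  surjective? = map′ (λ sur y → proj₁ (sur y) , λ z≡x → trans (cong f z≡x) (proj₂ (sur y)))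
                     (λ sur y → proj₁ (sur y) , proj₂ (sur y) refl)
    (all? λ y → any? λ x → f x ≟ y)
  adj? : Dec (∀ i j → adj H′ (f i) (f j) ≡ adj H i j)
  adj? = all? λ i → all? λ j → adj H′ (f i) (f j) Bool.≟ adj H i j

IsIsomorphism-resp-≗ : ∀ {H H′ f g} → (∀ i → f i ≡ g i) → IsIsomorphism H H′ f → IsIsomorphism H H′ g
IsIsomorphism-resp-≗ {H} {H′} f≗g (f-injective , f-surjective , f-adj) =
  (λ {x} {y} gx≡gy → f-injective (trans (f≗g x) (trans gx≡gy (sym (f≗g y))))) ,
  (λ y → proj₁ (f-surjective y) , λ {z} z≡x → trans (sym (f≗g z)) (proj₂ (f-surjective y) z≡x)) ,
  (λ i j → trans (sym (cong₂ (adj H′) (f≗g i) (f≗g j))) (f-adj i j))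

_≅?_ : ∀ H H′ → Dec (H ≅ H′)
H ≅? H′ with Any.any? (isIsomorphism? H H′) (allFunctions (n H) (allFin (n H′)))
... | yes iso = yes (Any.satisfied iso)
... | no ¬iso = no λ (f , f-iso) → ¬iso (Any.map (λ f≗g → IsIsomorphism-resp-≗ {H} {H′} f≗g f-iso)
                  (allFunctions-complete _≡_ (n H) _ f (λ i → ∈-allFin (f i))))

Connected? : ∀ H → Dec (Connected H)
Connected? H = inhabited? (n H) ×-dec (all? λ u → all? λ v → reach? H u v)
  where
  inhabited? : ∀ k → Dec (Fin k)
  inhabited? zero    = no λ ()
  inhabited? (suc k) = yes zero

MaxDeg≤? : ∀ H d → Dec (MaxDeg≤ H d)
MaxDeg≤? H d = all? λ v → degree H v ≤? d

-- A catalogue of all graphs with at most c vertices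

module Catalogue (c : ℕ) where

  symmetrise : ∀ {a} → (Fin a → Fin a → Bool) → Fin a → Fin a → Bool
  symmetrise u i j = (does (i <? j) ∧ u i j) ∨ (does (j <? i) ∧ u j i)

  graphOn : (a : ℕ) → (Fin a → Fin a → Bool) → Graph
  graphOn a u = record
    { n      = a
    ; adj    = symmetrise u
    ; sym    = λ i j → ∨-comm (does (i <? j) ∧ u i j) _
    ; irrefl = λ i → cong (λ b → (b ∧ u i i) ∨ (b ∧ u i i)) (dec-false (i <? i) (<-irrefl refl))
    }

  symmetrise-adj : ∀ H {u} → (∀ i j → adj H i j ≡ u i j) → ∀ i j → symmetrise u i j ≡ adj H i j
  symmetrise-adj H adj≗u i j with <-cmp i j
  ... | tri< i<j _ i≯j rewrite dec-true (i <? j) i<j | dec-false (j <? i) i≯j =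
        trans (∨-identityʳ _) (sym (adj≗u i j))
  ... | tri≈ i≮i refl _ rewrite dec-false (i <? i) i≮i = sym (irrefl H i)
  ... | tri> i≮j _ i>j rewrite dec-false (i <? j) i≮j | dec-true (j <? i) i>j =
        trans (sym (adj≗u j i)) (adj-sym H j i)

  graphsOfSize : ℕ → List Graph
  graphsOfSize a = map (graphOn a) (allFunctions a (allFunctions a (true ∷ false ∷ [])))

  graphsOfSize-complete : ∀ H → Any (H ≅_) (graphsOfSize (n H))
  graphsOfSize-complete H = AnyP.map⁺ (Any.map (λ adj≈u → H≅graphOn (λ i j → adj≈u i j))
    (allFunctions-complete (λ f g → ∀ j → f j ≡ g j) (n H) _ (adj H) λ i →
      allFunctions-complete _≡_ (n H) _ (adj H i) (λ j → bool∈ (adj H i j))))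
    where
    bool∈ : ∀ b → b ∈ true ∷ false ∷ []
    bool∈ true  = here refl
    bool∈ false = there (here refl)
    H≅graphOn : ∀ {u} → (∀ i j → adj H i j ≡ u i j) → H ≅ graphOn (n H) u
    H≅graphOn adj≗u = id , id , (λ y → y , id) , symmetrise-adj H adj≗u

  emptyGraph : Graph
  emptyGraph = record { n = 0 ; adj = λ () ; sym = λ () ; irrefl = λ () }

  -- The empty graph is listed first only so that Fin R visibly has an element,
  -- the junk value of canonicalIndex on graphs with more than c vertices.
  catalogue : List Graph
  catalogue = emptyGraph ∷ concatMap graphsOfSize (upTo (suc c))

  R : ℕ
  R = length catalogue

  graphAt : Fin R → Graph
  graphAt = lookup catalogue

  size : Fin R → ℕ
  size i = n (graphAt i)

  catalogue-complete : ∀ {H} → n H ≤ c → ∃ λ i → H ≅ graphAt i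
  catalogue-complete {H} small = suc (index H∈) , AnyP.lookup-index {P = H ≅_} H∈
    where
    H∈ : Any (H ≅_) (concatMap graphsOfSize (upTo (suc c)))
    H∈ = AnyP.concat⁺ (AnyP.map⁺ (lose {P = λ a → Any (H ≅_) (graphsOfSize a)}
                                        (∈-upTo⁺ (s≤s small)) (graphsOfSize-complete H)))

  size≤c : ∀ i → size i ≤ c
  size≤c zero    = z≤n
  size≤c (suc i) with find (∈-concatMap⁻ graphsOfSize {xs = upTo (suc c)} (∈-lookup i))
  ... | a , a∈ , H∈ with ∈-map⁻ (graphOn a) H∈
  ...   | _ , _ , H≡graphOn with ∈-upTo⁻ a∈
  ...     | s≤s a≤c = subst (_≤ c) (sym (cong n H≡graphOn)) a≤c

  canonicalIndex : Graph → Fin R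
  canonicalIndex H = fromMaybe zero (least (λ i → H ≅? graphAt i))

  canonicalIndex-≅ : ∀ {H} → n H ≤ c → H ≅ graphAt (canonicalIndex H)
  canonicalIndex-≅ {H} small with catalogue-complete {H} small
  ... | i , H≅i with least-complete (λ i → H ≅? graphAt i) {i} H≅i
  ... | j , least≡j rewrite least≡j = least-sound (λ i → H ≅? graphAt i) least≡j

  canonicalIndex-resp-≅ : ∀ {H H′} → H ≅ H′ → canonicalIndex H ≡ canonicalIndex H′
  canonicalIndex-resp-≅ {H} {H′} H≅H′ = cong (fromMaybe zero)
    (least-cong (λ i → H ≅? graphAt i) (λ i → H′ ≅? graphAt i)
      (λ i → ≅-trans {H′} {H} {graphAt i} (≅-sym {H} {H′} H≅H′)) (λ i → ≅-trans {H} {H′} {graphAt i} H≅H′))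

  Realizable : ℕ → Fin R → Set
  Realizable d i = canonicalIndex (graphAt i) ≡ i × Connected (graphAt i) × MaxDeg≤ (graphAt i) d

  realizable? : ∀ d i → Dec (Realizable d i)
  realizable? d i = (canonicalIndex (graphAt i) ≟ i) ×-dec Connected? (graphAt i) ×-dec MaxDeg≤? (graphAt i) d

-- Thresholds and periods

-- Counts a formula cannot tell apart: equal, or both at least k and congruent modulo L.
data CountEq (k L a b : ℕ) : Set where
  equal : a ≡ b → CountEq k L a b
  large : k ≤ a → k ≤ b → ∀ p q → a + p * L ≡ b + q * L → CountEq k L a b

module _ {k L : ℕ} where

  CountEq-mono : ∀ {k′ a b} → k′ ≤ k → CountEq k L a b → CountEq k′ L a b
  CountEq-mono k′≤k (equal a≡b)           = equal a≡b
  CountEq-mono k′≤k (large k≤a k≤b p q e) = large (≤-trans k′≤k k≤a) (≤-trans k′≤k k≤b) p q e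

  CountEq-∣ : ∀ {L′ a b} → L′ ∣ L → CountEq k L a b → CountEq k L′ a b
  CountEq-∣ L′∣L          (equal a≡b)           = equal a≡b
  CountEq-∣ {L′} {a} {b} (divides t refl) (large k≤a k≤b p q e) = large k≤a k≤b (p * t) (q * t)
    (subst₂ (λ x y → a + x ≡ b + y) (sym (*-assoc p t L′)) (sym (*-assoc q t L′)) e)

  CountEq-pred : ∀ {a b} → CountEq (suc k) L a b → CountEq k L (a ∸ 1) (b ∸ 1)
  CountEq-pred (equal a≡b)                           = equal (cong (_∸ 1) a≡b)
  CountEq-pred (large (s≤s k≤a) (s≤s k≤b) p q e)     = large k≤a k≤b p q (suc-injective e)

  CountEq-positive : ∀ {a b} → CountEq (suc k) L a b → (0 <ᵇ a) ≡ (0 <ᵇ b)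
  CountEq-positive (equal a≡b)                       = cong (0 <ᵇ_) a≡b
  CountEq-positive (large (s≤s _) (s≤s _) _ _ _)     = refl

  CountEq-*-% : ∀ {a b} s → .{{_ : NonZero L}} → CountEq k L a b → (a * s) % L ≡ (b * s) % L
  CountEq-*-% s (equal a≡b)           = cong (λ x → (x * s) % L) a≡b
  CountEq-*-% {a} {b} s (large _ _ p q e) = begin
    (a * s) % L                      ≡⟨ [m+kn]%n≡m%n (a * s) (p * s) L ⟨
    (a * s + p * s * L) % L          ≡⟨ cong (_% L) (shift a p) ⟩
    ((a + p * L) * s) % L            ≡⟨ cong (λ x → (x * s) % L) e ⟩
    ((b + q * L) * s) % L            ≡⟨ cong (_% L) (shift b q) ⟨
    (b * s + q * s * L) % L          ≡⟨ [m+kn]%n≡m%n (b * s) (q * s) L ⟩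
    (b * s) % L                      ∎
    where
    open ≡-Reasoning
    shift : ∀ x r → x * s + r * s * L ≡ (x + r * L) * s
    shift x r = solve 4 (λ x r s L → x :* s :+ r :* s :* L := (x :+ r :* L) :* s) refl x r s L

CountEq-suc : ∀ {k L a b} → CountEq (suc k) L a b → CountEq k L a b
CountEq-suc = CountEq-mono (n≤1+n _)

CountEq-⊔-*ˡ : ∀ {k k′ L} L′ {a b} → CountEq (k ⊔ k′) (L * L′) a b → CountEq k L a b
CountEq-⊔-*ˡ {k} {k′} L′ = CountEq-mono (m≤m⊔n k k′) ∘ CountEq-∣ (m∣m*n L′)

CountEq-⊔-*ʳ : ∀ {k k′} L {L′ a b} → CountEq (k ⊔ k′) (L * L′) a b → CountEq k′ L′ a b
CountEq-⊔-*ʳ {k} {k′} L = CountEq-mono (m≤n⊔m k k′) ∘ CountEq-∣ (n∣m*n L)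

sum-%-cong : ∀ {k} L .{{_ : NonZero L}} (f g : Fin k → ℕ) → (∀ i → f i % L ≡ g i % L) → sum f % L ≡ sum g % L
sum-%-cong {zero}  L f g f≡g = refl
sum-%-cong {suc k} L f g f≡g = begin
  (f zero + sum (f ∘ suc)) % L              ≡⟨ %-distribˡ-+ (f zero) _ L ⟩
  (f zero % L + sum (f ∘ suc) % L) % L      ≡⟨ cong₂ (λ x y → (x + y) % L) (f≡g zero) (sum-%-cong L _ _ (f≡g ∘ suc)) ⟩
  (g zero % L + sum (g ∘ suc) % L) % L      ≡⟨ %-distribˡ-+ (g zero) _ L ⟨
  (g zero + sum (g ∘ suc)) % L              ∎
  where open ≡-Reasoning

sum-bump : ∀ {k} (j : Fin k) (c x : Fin k → ℕ) →
           sum (λ i → if does (i ≟ j) then c i + x i else x i) ≡ c j + sum x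
sum-bump zero    c x = +-assoc (c zero) (x zero) _
sum-bump (suc j) c x = trans (cong (x zero +_) (sum-bump j (c ∘ suc) (x ∘ suc)))
                             (solve 3 (λ a b s → a :+ (b :+ s) := b :+ (a :+ s)) refl (x zero) (c (suc j)) _)

rank : ∀ {m} → Formula m → ℕ
rank (edge x y)        = 0
rank (eq x y)          = 0
rank (neg φ)           = rank φ
rank (and φ ψ)         = rank φ ⊔ rank ψ
rank (or φ ψ)          = rank φ ⊔ rank ψ
rank (ex φ)            = suc (rank φ)
rank (all φ)           = suc (rank φ)
rank (exmod j ℓ _ φ)   = suc (rank φ)

period : ∀ {m} → Formula m → ℕ
period (edge x y)              = 1
period (eq x y)                = 1
period (neg φ)                 = period φ
period (and φ ψ)               = period φ * period ψ
period (or φ ψ)                = period φ * period ψ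
period (ex φ)                  = period φ
period (all φ)                 = period φ
period (exmod j zero () φ)
period (exmod j (suc ℓ) _ φ)   = period φ * suc ℓ

period-nonZero : ∀ {m} (φ : Formula m) → NonZero (period φ)
period-nonZero (edge x y)             = _
period-nonZero (eq x y)               = _
period-nonZero (neg φ)                = period-nonZero φ
period-nonZero (and φ ψ)              = m*n≢0 _ _ {{period-nonZero φ}} {{period-nonZero ψ}}
period-nonZero (or φ ψ)               = m*n≢0 _ _ {{period-nonZero φ}} {{period-nonZero ψ}}
period-nonZero (ex φ)                 = period-nonZero φ
period-nonZero (all φ)                = period-nonZero φ
period-nonZero (exmod j (suc ℓ) _ φ)  = m*n≢0 _ _ {{period-nonZero φ}}

-- Evaluation on disjoint unions of blocks

extend-cong : ∀ {m N} x {ρ ρ′ : Fin m → Fin N} → (∀ k → ρ k ≡ ρ′ k) → ∀ k → extend x ρ k ≡ extend x ρ′ k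
extend-cong x ρ≗ρ′ zero    = refl
extend-cong x ρ≗ρ′ (suc k) = ρ≗ρ′ k

⌊≟⌋-injective : ∀ (_≟ᴬ_ : DecidableEquality A) (_≟ᴮ_ : DecidableEquality B) {f : A → B} →
                   (∀ {a b} → f a ≡ f b → a ≡ b) → ∀ a b → ⌊ f a ≟ᴮ f b ⌋ ≡ ⌊ a ≟ᴬ b ⌋
⌊≟⌋-injective _≟ᴬ_ _≟ᴮ_ {f} f-injective a b with a ≟ᴬ b | f a ≟ᴮ f b
... | yes refl | yes _     = refl
... | yes refl | no fa≢fa  = ⊥-elim (fa≢fa refl)
... | no a≢b   | yes fa≡fb = ⊥-elim (a≢b (f-injective fa≡fb))
... | no _     | no _      = refl

eval-cong : ∀ G {m} (φ : Formula m) {ρ ρ′ : Fin m → Fin (n G)} → (∀ k → ρ k ≡ ρ′ k) → eval G φ ρ ≡ eval G φ ρ′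
eval-cong G (edge x y) ρ≗ρ′ = cong₂ (adj G) (ρ≗ρ′ x) (ρ≗ρ′ y)
eval-cong G (eq x y)   ρ≗ρ′ = cong₂ (λ a b → ⌊ a ≟ b ⌋) (ρ≗ρ′ x) (ρ≗ρ′ y)
eval-cong G (neg φ)    ρ≗ρ′ = cong not (eval-cong G φ ρ≗ρ′)
eval-cong G (and φ ψ)  ρ≗ρ′ = cong₂ _∧_ (eval-cong G φ ρ≗ρ′) (eval-cong G ψ ρ≗ρ′)
eval-cong G (or φ ψ)   ρ≗ρ′ = cong₂ _∨_ (eval-cong G φ ρ≗ρ′) (eval-cong G ψ ρ≗ρ′)
eval-cong G (ex φ)     ρ≗ρ′ = any-cong (allFin (n G)) (λ x → eval-cong G φ (extend-cong x ρ≗ρ′))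
eval-cong G (all φ)    ρ≗ρ′ = cong not (any-cong (allFin (n G)) (λ x → cong not (eval-cong G φ (extend-cong x ρ≗ρ′))))
eval-cong G (exmod j (suc ℓ) _ φ) ρ≗ρ′ = cong (λ bs → (countTrue bs % suc ℓ) ≡ᵇ j)
  (map-cong (λ x → eval-cong G φ (extend-cong x ρ≗ρ′)) (allFin (n G)))

-- evalᵃ P h φ ρ evaluates φ on the disjoint union of the blocks listed in P and
-- h i further blocks of each type i.  The variables point into P only: a quantified
-- variable either lands in P or in a fresh block, which is then moved into P.
module DisjointUnion {R : ℕ} (size : Fin R → ℕ) (blockAdj : ∀ i → Fin (size i) → Fin (size i) → Bool) where

  Vertex : List (Fin R) → Set
  Vertex []      = ⊥
  Vertex (i ∷ Q) = Fin (size i) ⊎ Vertex Q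

  vertices : ∀ Q → List (Vertex Q)
  vertices []      = []
  vertices (i ∷ Q) = map inj₁ (allFin (size i)) ++ map inj₂ (vertices Q)

  adjᵛ : ∀ {Q} → Vertex Q → Vertex Q → Bool
  adjᵛ {i ∷ Q} (inj₁ a) (inj₁ b) = blockAdj i a b
  adjᵛ {i ∷ Q} (inj₁ a) (inj₂ b) = false
  adjᵛ {i ∷ Q} (inj₂ a) (inj₁ b) = false
  adjᵛ {i ∷ Q} (inj₂ a) (inj₂ b) = adjᵛ a b

  _≟ᵛ_ : ∀ {Q} → DecidableEquality (Vertex Q)
  _≟ᵛ_ {i ∷ Q} = ≡-dec _≟_ _≟ᵛ_

  extendᵛ : ∀ {m Q} → Vertex Q → (Fin m → Vertex Q) → Fin (suc m) → Vertex Q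
  extendᵛ x ρ zero    = x
  extendᵛ x ρ (suc k) = ρ k

  Histogram : Set
  Histogram = Fin R → ℕ

  decrement : Fin R → Histogram → Histogram
  decrement i h j = if does (j ≟ i) then h j ∸ 1 else h j

  Semantics : ℕ → Set
  Semantics m = ∀ P → Histogram → (Fin m → Vertex P) → Bool

  inFreshBlock : ∀ {m P} → Semantics (suc m) → Histogram → (Fin m → Vertex P) → ∀ i → Fin (size i) → Bool
  inFreshBlock {P = P} S h ρ i v = S (i ∷ P) (decrement i h) (extendᵛ (inj₁ v) (inj₂ ∘ ρ))

  existsᵃ : ∀ {m} P → Histogram → Semantics (suc m) → (Fin m → Vertex P) → Bool
  existsᵃ P h S ρ = any (λ y → S P h (extendᵛ y ρ)) (vertices P)
                  ∨ any (λ i → (0 <ᵇ h i) ∧ any (inFreshBlock S h ρ i) (allFin (size i))) (allFin R)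

  countᵃ : ∀ {m} P → Histogram → Semantics (suc m) → (Fin m → Vertex P) → ℕ
  countᵃ P h S ρ = countᵇ (λ y → S P h (extendᵛ y ρ)) (vertices P)
                 + sum (λ i → h i * countᵇ (inFreshBlock S h ρ i) (allFin (size i)))

  evalᵃ : ∀ {m} P → Histogram → Formula m → (Fin m → Vertex P) → Bool
  evalᵃ P h (edge x y)             ρ = adjᵛ (ρ x) (ρ y)
  evalᵃ P h (eq x y)               ρ = ⌊ ρ x ≟ᵛ ρ y ⌋
  evalᵃ P h (neg φ)                ρ = not (evalᵃ P h φ ρ)
  evalᵃ P h (and φ ψ)              ρ = evalᵃ P h φ ρ ∧ evalᵃ P h ψ ρ
  evalᵃ P h (or φ ψ)               ρ = evalᵃ P h φ ρ ∨ evalᵃ P h ψ ρ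
  evalᵃ P h (ex φ)                 ρ = existsᵃ P h (λ P′ h′ → evalᵃ P′ h′ φ) ρ
  evalᵃ P h (all φ)                ρ = not (existsᵃ P h (λ P′ h′ → not ∘ evalᵃ P′ h′ φ) ρ)
  evalᵃ P h (exmod j (suc ℓ) _ φ)  ρ = (countᵃ P h (λ P′ h′ → evalᵃ P′ h′ φ) ρ % suc ℓ) ≡ᵇ j

  ⟦_⟧ᵃ : ∀ {m} → Formula m → Semantics m
  ⟦ φ ⟧ᵃ P h = evalᵃ P h φ

  decrement-CountEq : ∀ {k L} {h h′ : Histogram} → (∀ i → CountEq (suc k) L (h i) (h′ i)) →
                      ∀ j i → CountEq k L (decrement j h i) (decrement j h′ i)
  decrement-CountEq h≈h′ j i with does (i ≟ j)
  ... | true  = CountEq-pred (h≈h′ i)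
  ... | false = CountEq-mono (n≤1+n _) (h≈h′ i)

  module _ {m} P {h h′ : Histogram} (S S′ : Semantics (suc m)) (ρ : Fin m → Vertex P)
           (S≡S′ : ∀ ρ′ → S P h ρ′ ≡ S′ P h′ ρ′)
           (S≡S′-fresh : ∀ i ρ′ → S (i ∷ P) (decrement i h) ρ′ ≡ S′ (i ∷ P) (decrement i h′) ρ′) where

    existsᵃ-cong : (∀ i → (0 <ᵇ h i) ≡ (0 <ᵇ h′ i)) → existsᵃ P h S ρ ≡ existsᵃ P h′ S′ ρ
    existsᵃ-cong h>0≡h′>0 = cong₂ _∨_
      (any-cong (vertices P) (λ y → S≡S′ (extendᵛ y ρ)))
      (any-cong (allFin R) λ i → cong₂ _∧_ (h>0≡h′>0 i) (any-cong (allFin (size i)) (λ v → S≡S′-fresh i _)))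

    countᵃ-%-cong : ∀ ℓ .{{_ : NonZero ℓ}} → (∀ i s → (h i * s) % ℓ ≡ (h′ i * s) % ℓ) →
                    countᵃ P h S ρ % ℓ ≡ countᵃ P h′ S′ ρ % ℓ
    countᵃ-%-cong ℓ h≡h′ = begin
      (pinned h S + fresh h S) % ℓ                   ≡⟨ %-distribˡ-+ (pinned h S) _ ℓ ⟩
      (pinned h S % ℓ + fresh h S % ℓ) % ℓ           ≡⟨ cong₂ (λ x y → (x % ℓ + y) % ℓ) pinned≡ fresh≡ ⟩
      (pinned h′ S′ % ℓ + fresh h′ S′ % ℓ) % ℓ       ≡⟨ %-distribˡ-+ (pinned h′ S′) _ ℓ ⟨
      (pinned h′ S′ + fresh h′ S′) % ℓ               ∎
      where
      open ≡-Reasoning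
      pinned : Histogram → Semantics (suc m) → ℕ
      pinned g T = countᵇ (λ y → T P g (extendᵛ y ρ)) (vertices P)
      fresh : Histogram → Semantics (suc m) → ℕ
      fresh g T = sum (λ i → g i * countᵇ (inFreshBlock T g ρ i) (allFin (size i)))
      pinned≡ : pinned h S ≡ pinned h′ S′
      pinned≡ = countᵇ-cong (vertices P) (λ y → S≡S′ (extendᵛ y ρ))
      fresh≡ : fresh h S % ℓ ≡ fresh h′ S′ % ℓ
      fresh≡ = sum-%-cong ℓ _ _ λ i →
        trans (cong (λ x → (h i * x) % ℓ) (countᵇ-cong (allFin (size i)) (λ v → S≡S′-fresh i _))) (h≡h′ i _)

  evalᵃ-CountEq : ∀ {m} (φ : Formula m) P {h h′ : Histogram} ρ →
                  (∀ i → CountEq (rank φ) (period φ) (h i) (h′ i)) → evalᵃ P h φ ρ ≡ evalᵃ P h′ φ ρ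
  evalᵃ-CountEq (edge x y) P ρ h≈h′ = refl
  evalᵃ-CountEq (eq x y)   P ρ h≈h′ = refl
  evalᵃ-CountEq (neg φ)    P ρ h≈h′ = cong not (evalᵃ-CountEq φ P ρ h≈h′)
  evalᵃ-CountEq (and φ ψ)  P ρ h≈h′ =
    cong₂ _∧_ (evalᵃ-CountEq φ P ρ (CountEq-⊔-*ˡ (period ψ) ∘ h≈h′))
              (evalᵃ-CountEq ψ P ρ (CountEq-⊔-*ʳ (period φ) ∘ h≈h′))
  evalᵃ-CountEq (or φ ψ)   P ρ h≈h′ =
    cong₂ _∨_ (evalᵃ-CountEq φ P ρ (CountEq-⊔-*ˡ (period ψ) ∘ h≈h′))
              (evalᵃ-CountEq ψ P ρ (CountEq-⊔-*ʳ (period φ) ∘ h≈h′))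
  evalᵃ-CountEq (ex φ)     P {h} {h′} ρ h≈h′ = existsᵃ-cong P {h} {h′} ⟦ φ ⟧ᵃ ⟦ φ ⟧ᵃ ρ
    (λ ρ′ → evalᵃ-CountEq φ P ρ′ (CountEq-suc ∘ h≈h′))
    (λ i ρ′ → evalᵃ-CountEq φ (i ∷ P) ρ′ (decrement-CountEq h≈h′ i))
    (CountEq-positive ∘ h≈h′)
  evalᵃ-CountEq {m} (all φ) P {h} {h′} ρ h≈h′ = cong not (existsᵃ-cong P {h} {h′} ¬⟦φ⟧ ¬⟦φ⟧ ρ
    (λ ρ′ → cong not (evalᵃ-CountEq φ P ρ′ (CountEq-suc ∘ h≈h′)))
    (λ i ρ′ → cong not (evalᵃ-CountEq φ (i ∷ P) ρ′ (decrement-CountEq h≈h′ i)))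
    (CountEq-positive ∘ h≈h′))
    where
    ¬⟦φ⟧ : Semantics (suc m)
    ¬⟦φ⟧ P′ g = not ∘ evalᵃ P′ g φ
  evalᵃ-CountEq (exmod j (suc ℓ) _ φ) P {h} {h′} ρ h≈h′ = cong (_≡ᵇ j) (countᵃ-%-cong P {h} {h′} ⟦ φ ⟧ᵃ ⟦ φ ⟧ᵃ ρ
    (λ ρ′ → evalᵃ-CountEq φ P ρ′ (CountEq-suc ∘ h≈h′-mod-period))
    (λ i ρ′ → evalᵃ-CountEq φ (i ∷ P) ρ′ (decrement-CountEq h≈h′-mod-period i))
    (suc ℓ) (λ i s → CountEq-*-% s (CountEq-∣ (n∣m*n (period φ)) (h≈h′ i))))
    where
    h≈h′-mod-period : ∀ i → CountEq (suc (rank φ)) (period φ) (h i) (h′ i)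
    h≈h′-mod-period = CountEq-∣ (m∣m*n (suc ℓ)) ∘ h≈h′

  vertices-complete : ∀ Q (a : Vertex Q) → a ∈ vertices Q
  vertices-complete (i ∷ Q) (inj₁ v) = ∈-++⁺ˡ (∈-map⁺ inj₁ (∈-allFin v))
  vertices-complete (i ∷ Q) (inj₂ a) = ∈-++⁺ʳ (map inj₁ (allFin (size i))) (∈-map⁺ inj₂ (vertices-complete Q a))

  vertices-unique : ∀ Q → Unique (vertices Q)
  vertices-unique []      = []
  vertices-unique (i ∷ Q) = UP.++⁺ (UP.map⁺ inj₁-injective (UP.allFin⁺ (size i)))
                                   (UP.map⁺ inj₂-injective (vertices-unique Q)) disjoint
    where
    disjoint : ∀ {a} → ¬ (a ∈ map inj₁ (allFin (size i)) × a ∈ map inj₂ (vertices Q))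
    disjoint (a∈₁ , a∈₂) with ∈-map⁻ inj₁ a∈₁ | ∈-map⁻ inj₂ a∈₂
    ... | _ , _ , refl | _ , _ , ()

  embedˡ : ∀ P F → Vertex P → Vertex (P ++ F)
  embedˡ (i ∷ P) F (inj₁ v) = inj₁ v
  embedˡ (i ∷ P) F (inj₂ a) = inj₂ (embedˡ P F a)

  embedʳ : ∀ P F → Vertex F → Vertex (P ++ F)
  embedʳ []      F w = w
  embedʳ (i ∷ P) F w = inj₂ (embedʳ P F w)

  embedˡ-injective : ∀ P F {a b} → embedˡ P F a ≡ embedˡ P F b → a ≡ b
  embedˡ-injective (i ∷ P) F {inj₁ a} {inj₁ b} refl = refl
  embedˡ-injective (i ∷ P) F {inj₂ a} {inj₂ b} e    = cong inj₂ (embedˡ-injective P F (inj₂-injective e))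

  embedˡ-adj : ∀ P F a b → adjᵛ (embedˡ P F a) (embedˡ P F b) ≡ adjᵛ a b
  embedˡ-adj (i ∷ P) F (inj₁ a) (inj₁ b) = refl
  embedˡ-adj (i ∷ P) F (inj₁ a) (inj₂ b) = refl
  embedˡ-adj (i ∷ P) F (inj₂ a) (inj₁ b) = refl
  embedˡ-adj (i ∷ P) F (inj₂ a) (inj₂ b) = embedˡ-adj P F a b

  vertices-++ : ∀ P F → vertices (P ++ F) ≡ map (embedˡ P F) (vertices P) ++ map (embedʳ P F) (vertices F)
  vertices-++ []      F = sym (map-id (vertices F))
  vertices-++ (i ∷ P) F = begin
    map inj₁ block ++ map inj₂ (vertices (P ++ F))
      ≡⟨ cong (λ vs → map inj₁ block ++ map inj₂ vs) (vertices-++ P F) ⟩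
    map inj₁ block ++ map inj₂ (map ιˡ (vertices P) ++ map ιʳ (vertices F))
      ≡⟨ cong (map inj₁ block ++_) (map-++ inj₂ (map ιˡ (vertices P)) _) ⟩
    map inj₁ block ++ (map inj₂ (map ιˡ (vertices P)) ++ map inj₂ (map ιʳ (vertices F)))
      ≡⟨ ++-assoc (map inj₁ block) _ _ ⟨
    (map inj₁ block ++ map inj₂ (map ιˡ (vertices P))) ++ map inj₂ (map ιʳ (vertices F))
      ≡⟨ cong₂ (λ xs ys → (map inj₁ block ++ xs) ++ ys) (map-∘ (vertices P)) (map-∘ (vertices F)) ⟨
    (map inj₁ block ++ map (inj₂ ∘ ιˡ) (vertices P)) ++ map (inj₂ ∘ ιʳ) (vertices F)
      ≡⟨ cong (_++ map (inj₂ ∘ ιʳ) (vertices F)) (trans (map-++ (embedˡ (i ∷ P) F) (map inj₁ block) (map inj₂ (vertices P)))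
                             (cong₂ _++_ (sym (map-∘ block)) (sym (map-∘ (vertices P))))) ⟨
    map (embedˡ (i ∷ P) F) (map inj₁ block ++ map inj₂ (vertices P)) ++ map (inj₂ ∘ ιʳ) (vertices F)
      ∎
    where
    open ≡-Reasoning
    block : List (Fin (size i))
    block = allFin (size i)
    ιˡ : Vertex P → Vertex (P ++ F)
    ιˡ = embedˡ P F
    ιʳ : Vertex F → Vertex (P ++ F)
    ιʳ = embedʳ P F

  any-vertices-++ : ∀ P F (g : Vertex (P ++ F) → Bool) →
    any g (vertices (P ++ F)) ≡ any (g ∘ embedˡ P F) (vertices P) ∨ any (g ∘ embedʳ P F) (vertices F)
  any-vertices-++ P F g = trans (cong (any g) (vertices-++ P F))
    (trans (any-++ g (map (embedˡ P F) (vertices P)) _)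
           (cong₂ _∨_ (any-map g (embedˡ P F) (vertices P)) (any-map g (embedʳ P F) (vertices F))))

  countᵇ-vertices-++ : ∀ P F (g : Vertex (P ++ F) → Bool) →
    countᵇ g (vertices (P ++ F)) ≡ countᵇ (g ∘ embedˡ P F) (vertices P) + countᵇ (g ∘ embedʳ P F) (vertices F)
  countᵇ-vertices-++ P F g = trans (cong (countᵇ g) (vertices-++ P F))
    (trans (countᵇ-++ g (map (embedˡ P F) (vertices P)) _)
           (cong₂ _+_ (countᵇ-map g (embedˡ P F) (vertices P)) (countᵇ-map g (embedʳ P F) (vertices F))))

  record Relabelling (Q Q′ : List (Fin R)) : Set where
    field
      to      : Vertex Q → Vertex Q′
      from    : Vertex Q′ → Vertex Q
      to∘from : ∀ y → to (from y) ≡ y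
      from∘to : ∀ x → from (to x) ≡ x
      to-adj  : ∀ a b → adjᵛ (to a) (to b) ≡ adjᵛ a b
  open Relabelling

  record Decomposition (G : Graph) (Q : List (Fin R)) : Set where
    field
      embed            : Vertex Q → Fin (n G)
      embed-injective  : ∀ {a b} → embed a ≡ embed b → a ≡ b
      embed-surjective : ∀ x → ∃ λ a → embed a ≡ x
      embed-adj        : ∀ a b → adj G (embed a) (embed b) ≡ adjᵛ a b
  open Decomposition public

  relabel : ∀ {G Q Q′} → Decomposition G Q′ → Relabelling Q Q′ → Decomposition G Q
  relabel D σ = record
    { embed            = embed D ∘ to σ
    ; embed-injective  = λ {a} {b} e → trans (sym (from∘to σ a)) (trans (cong (from σ) (embed-injective D e)) (from∘to σ b))
    ; embed-surjective = λ x → let (a , ea≡x) = embed-surjective D x in from σ a , trans (cong (embed D) (to∘from σ a)) ea≡x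
    ; embed-adj        = λ a b → trans (embed-adj D (to σ a) (to σ b)) (to-adj σ a b)
    }

  identity : ∀ {Q} → Relabelling Q Q
  identity = record { to = id ; from = id ; to∘from = λ _ → refl ; from∘to = λ _ → refl ; to-adj = λ _ _ → refl }

  module _ {i j : Fin R} {X Y : List (Fin R)} (σ : Relabelling (i ∷ X) Y) where

    private
      lift : Vertex (i ∷ X) → Vertex (i ∷ j ∷ X)
      lift (inj₁ v) = inj₁ v
      lift (inj₂ a) = inj₂ (inj₂ a)

      forward : Vertex (i ∷ j ∷ X) → Vertex (j ∷ Y)
      forward (inj₁ v)        = inj₂ (to σ (inj₁ v))
      forward (inj₂ (inj₁ u)) = inj₁ u
      forward (inj₂ (inj₂ a)) = inj₂ (to σ (inj₂ a))

      backward : Vertex (j ∷ Y) → Vertex (i ∷ j ∷ X)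
      backward (inj₁ u) = inj₂ (inj₁ u)
      backward (inj₂ y) = lift (from σ y)

      forward∘lift : ∀ z → forward (lift z) ≡ inj₂ (to σ z)
      forward∘lift (inj₁ v) = refl
      forward∘lift (inj₂ a) = refl

      forward∘backward : ∀ y → forward (backward y) ≡ y
      forward∘backward (inj₁ u) = refl
      forward∘backward (inj₂ y) = trans (forward∘lift (from σ y)) (cong inj₂ (to∘from σ y))

      backward∘forward : ∀ x → backward (forward x) ≡ x
      backward∘forward (inj₁ v)        = cong lift (from∘to σ (inj₁ v))
      backward∘forward (inj₂ (inj₁ u)) = refl
      backward∘forward (inj₂ (inj₂ a)) = cong lift (from∘to σ (inj₂ a))

      forward-adj : ∀ a b → adjᵛ (forward a) (forward b) ≡ adjᵛ a b
      forward-adj (inj₁ v)        (inj₁ v′)       = to-adj σ (inj₁ v) (inj₁ v′)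
      forward-adj (inj₁ v)        (inj₂ (inj₁ u)) = refl
      forward-adj (inj₁ v)        (inj₂ (inj₂ b)) = to-adj σ (inj₁ v) (inj₂ b)
      forward-adj (inj₂ (inj₁ u)) (inj₁ v)        = refl
      forward-adj (inj₂ (inj₁ u)) (inj₂ (inj₁ u′)) = refl
      forward-adj (inj₂ (inj₁ u)) (inj₂ (inj₂ b)) = refl
      forward-adj (inj₂ (inj₂ a)) (inj₁ v)        = to-adj σ (inj₂ a) (inj₁ v)
      forward-adj (inj₂ (inj₂ a)) (inj₂ (inj₁ u)) = refl
      forward-adj (inj₂ (inj₂ a)) (inj₂ (inj₂ b)) = to-adj σ (inj₂ a) (inj₂ b)

    bubble : Relabelling (i ∷ j ∷ X) (j ∷ Y)
    bubble = record { to = forward ; from = backward ; to∘from = forward∘backward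
                    ; from∘to = backward∘forward ; to-adj = forward-adj }

  blockType : ∀ F → Vertex F → Fin R
  blockType (i ∷ F) (inj₁ v) = i
  blockType (i ∷ F) (inj₂ w) = blockType F w

  localVertex : ∀ F (w : Vertex F) → Fin (size (blockType F w))
  localVertex (i ∷ F) (inj₁ v) = v
  localVertex (i ∷ F) (inj₂ w) = localVertex F w

  otherBlocks : ∀ F → Vertex F → List (Fin R)
  otherBlocks (i ∷ F) (inj₁ v) = F
  otherBlocks (i ∷ F) (inj₂ w) = i ∷ otherBlocks F w

  bringToFront : ∀ P F (w : Vertex F) → Relabelling (blockType F w ∷ (P ++ otherBlocks F w)) (P ++ F)
  bringToFront []      (i ∷ F) (inj₁ v) = identity
  bringToFront []      (i ∷ F) (inj₂ w) = bubble (bringToFront [] F w)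
  bringToFront (j ∷ P) F       w        = bubble (bringToFront P F w)

  bringToFront-block : ∀ P F w → to (bringToFront P F w) (inj₁ (localVertex F w)) ≡ embedʳ P F w
  bringToFront-block []      (i ∷ F) (inj₁ v) = refl
  bringToFront-block []      (i ∷ F) (inj₂ w) = cong inj₂ (bringToFront-block [] F w)
  bringToFront-block (j ∷ P) F       w        = cong inj₂ (bringToFront-block P F w)

  bringToFront-pinned : ∀ P F w (a : Vertex P) →
                        to (bringToFront P F w) (inj₂ (embedˡ P (otherBlocks F w) a)) ≡ embedˡ P F a
  bringToFront-pinned (j ∷ P) F w (inj₁ u) = refl
  bringToFront-pinned (j ∷ P) F w (inj₂ a) = cong inj₂ (bringToFront-pinned P F w a)

  histogram : List (Fin R) → Histogram
  histogram []      i = 0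
  histogram (j ∷ F) i = if does (i ≟ j) then suc (histogram F i) else histogram F i

  histogram-blockType-pos : ∀ F w → 0 < histogram F (blockType F w)
  histogram-blockType-pos (i ∷ F) (inj₁ v) rewrite dec-true (i ≟ i) refl = s≤s z≤n
  histogram-blockType-pos (i ∷ F) (inj₂ w) with does (blockType F w ≟ i)
  ... | true  = s≤s z≤n
  ... | false = histogram-blockType-pos F w

  histogram-otherBlocks : ∀ F w i → histogram (otherBlocks F w) i ≡ decrement (blockType F w) (histogram F) i
  histogram-otherBlocks (j ∷ F) (inj₁ v) i with does (i ≟ j)
  ... | true  = refl
  ... | false = refl
  histogram-otherBlocks (j ∷ F) (inj₂ w) i with i ≟ blockType F w | i ≟ j | histogram-otherBlocks F w i
  ... | yes refl | yes _ | IH = trans (cong suc IH) (suc-pred _ {{>-nonZero (histogram-blockType-pos F w)}})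
  ... | yes refl | no  _ | IH = IH
  ... | no  _    | yes _ | IH = cong suc IH
  ... | no  _    | no  _ | IH = IH

  histogram-map : ∀ (f : A → Fin R) xs i → histogram (map f xs) i ≡ length (filter (λ x → i ≟ f x) xs)
  histogram-map f []       i = refl
  histogram-map f (x ∷ xs) i with does (i ≟ f x)
  ... | true  = cong suc (histogram-map f xs i)
  ... | false = histogram-map f xs i

  tag : ∀ F → Vertex F → Σ (Fin R) (Fin ∘ size)
  tag F w = blockType F w , localVertex F w

  vertex-of-type : ∀ F {i} → 0 < histogram F i → ∀ v → ∃ λ w → tag F w ≡ (i , v)
  vertex-of-type (j ∷ F) {i} pos v with i ≟ j
  ... | yes refl = inj₁ v , refl
  ... | no  _    = let (w , tag≡) = vertex-of-type F pos v in inj₂ w , tag≡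

  any-fresh : ∀ F (S : ∀ i → Fin (size i) → Bool) →
    any (λ w → S (blockType F w) (localVertex F w)) (vertices F)
      ≡ any (λ i → (0 <ᵇ histogram F i) ∧ any (S i) (allFin (size i))) (allFin R)
  any-fresh F S = T-ext into outof
    where
    anyVertex anyType : Bool
    anyVertex = any (λ w → S (blockType F w) (localVertex F w)) (vertices F)
    anyType = any (λ i → (0 <ᵇ histogram F i) ∧ any (S i) (allFin (size i))) (allFin R)
    into : T anyVertex → T anyType
    into holds =
      let (w , Sw) = Any.satisfied (any⁻ _ (vertices F) holds)
      in any⁺ _ (lose (∈-allFin (blockType F w)) (Equivalence.from T-∧
           (<⇒<ᵇ (histogram-blockType-pos F w) , any⁺ _ (lose (∈-allFin (localVertex F w)) Sw))))
    outof : T anyType → T anyVertex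
    outof holds =
      let (i , pos∧Si) = Any.satisfied (any⁻ _ (allFin R) holds)
          (pos , Si) = Equivalence.to T-∧ pos∧Si
          (v , Siv) = Any.satisfied (any⁻ _ (allFin (size i)) Si)
          (w , tag≡) = vertex-of-type F (<ᵇ⇒< 0 _ pos) v
      in any⁺ _ (lose (vertices-complete F w) (subst (λ (i , v) → T (S i v)) (sym tag≡) Siv))

  countᵇ-fresh : ∀ F (S : ∀ i → Fin (size i) → Bool) →
    countᵇ (λ w → S (blockType F w) (localVertex F w)) (vertices F)
      ≡ sum (λ i → histogram F i * countᵇ (S i) (allFin (size i)))
  countᵇ-fresh []      S = sym (sum-replicate-zero R)
  countᵇ-fresh (j ∷ F) S = begin
    countᵇ S∘tag (map inj₁ (allFin (size j)) ++ map inj₂ (vertices F))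
      ≡⟨ countᵇ-++ S∘tag (map inj₁ (allFin (size j))) _ ⟩
    countᵇ S∘tag (map inj₁ (allFin (size j))) + countᵇ S∘tag (map inj₂ (vertices F))
      ≡⟨ cong₂ _+_ (countᵇ-map S∘tag inj₁ (allFin (size j)))
                   (trans (countᵇ-map S∘tag inj₂ (vertices F)) (countᵇ-fresh F S)) ⟩
    c j + sum (λ i → histogram F i * c i)
      ≡⟨ sum-bump j c (λ i → histogram F i * c i) ⟨
    sum (λ i → if does (i ≟ j) then c i + histogram F i * c i else histogram F i * c i)
      ≡⟨ sum-cong-≗ (λ i → *-distribʳ-if (does (i ≟ j))) ⟩
    sum (λ i → histogram (j ∷ F) i * c i)
      ∎
    where
    open ≡-Reasoning
    S∘tag : Vertex (j ∷ F) → Bool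
    S∘tag w = S (blockType (j ∷ F) w) (localVertex (j ∷ F) w)
    c : Fin R → ℕ
    c i = countᵇ (S i) (allFin (size i))
    *-distribʳ-if : ∀ {h x} b → (if b then x + h * x else h * x) ≡ (if b then suc h else h) * x
    *-distribʳ-if true  = refl
    *-distribʳ-if false = refl

  module _ (G : Graph) where

    any-Decomposition : ∀ {Q} (D : Decomposition G Q) (g : Fin (n G) → Bool) →
                        any g (allFin (n G)) ≡ any (g ∘ embed D) (vertices Q)
    any-Decomposition {Q} D = any-enumeration (embed D) (embed-injective D) (embed-surjective D)
                                              (vertices-unique Q) (vertices-complete Q)

    countᵇ-Decomposition : ∀ {Q} (D : Decomposition G Q) (g : Fin (n G) → Bool) →
                           countᵇ g (allFin (n G)) ≡ countᵇ (g ∘ embed D) (vertices Q)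
    countᵇ-Decomposition {Q} D = countᵇ-enumeration (embed D) (embed-injective D) (embed-surjective D)
                                                    (vertices-unique Q) (vertices-complete Q)

    Correct : ∀ {m} → Formula m → Set
    Correct φ = ∀ P F (D : Decomposition G (P ++ F)) ρ →
                eval G φ (embed D ∘ embedˡ P F ∘ ρ) ≡ evalᵃ P (histogram F) φ ρ

    module Quantifier {m} (φ : Formula (suc m)) (IH : Correct φ)
                      (P F : List (Fin R)) (D : Decomposition G (P ++ F)) (ρ : Fin m → Vertex P) where

      body : Fin (n G) → Bool
      body x = eval G φ (extend x (embed D ∘ embedˡ P F ∘ ρ))

      body-pinned : ∀ y → body (embed D (embedˡ P F y)) ≡ evalᵃ P (histogram F) φ (extendᵛ y ρ)
      body-pinned y = trans (eval-cong G φ λ { zero → refl ; (suc k) → refl }) (IH P F D (extendᵛ y ρ))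

      body-fresh : ∀ w → body (embed D (embedʳ P F w)) ≡
                   inFreshBlock ⟦ φ ⟧ᵃ (histogram F) ρ (blockType F w) (localVertex F w)
      body-fresh w = begin
        body (embed D (embedʳ P F w))
          ≡⟨ eval-cong G φ same-environment ⟩
        eval G φ (embed D′ ∘ embedˡ (t ∷ P) F′ ∘ ρ′)
          ≡⟨ IH (t ∷ P) F′ D′ ρ′ ⟩
        evalᵃ (t ∷ P) (histogram F′) φ ρ′
          ≡⟨ evalᵃ-CountEq φ (t ∷ P) ρ′ (equal ∘ histogram-otherBlocks F w) ⟩
        evalᵃ (t ∷ P) (decrement t (histogram F)) φ ρ′
          ∎
        where
        open ≡-Reasoning
        t : Fin R
        t = blockType F w
        F′ : List (Fin R)
        F′ = otherBlocks F w
        D′ : Decomposition G ((t ∷ P) ++ F′)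
        D′ = relabel D (bringToFront P F w)
        ρ′ : Fin (suc m) → Vertex (t ∷ P)
        ρ′ = extendᵛ (inj₁ (localVertex F w)) (inj₂ ∘ ρ)
        same-environment : ∀ k → extend (embed D (embedʳ P F w)) (embed D ∘ embedˡ P F ∘ ρ) k
                                 ≡ embed D′ (embedˡ (t ∷ P) F′ (ρ′ k))
        same-environment zero    = cong (embed D) (sym (bringToFront-block P F w))
        same-environment (suc k) = cong (embed D) (sym (bringToFront-pinned P F w (ρ k)))

      any-body : ∀ (b : Bool → Bool) →
                 any (b ∘ body) (allFin (n G)) ≡ existsᵃ P (histogram F) (λ P′ h → b ∘ evalᵃ P′ h φ) ρ
      any-body b = begin
        any (b ∘ body) (allFin (n G))
          ≡⟨ any-Decomposition D (b ∘ body) ⟩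
        any (b ∘ body ∘ embed D) (vertices (P ++ F))
          ≡⟨ any-vertices-++ P F (b ∘ body ∘ embed D) ⟩
        any (b ∘ body ∘ embed D ∘ embedˡ P F) (vertices P) ∨ any (b ∘ body ∘ embed D ∘ embedʳ P F) (vertices F)
          ≡⟨ cong₂ _∨_ (any-cong (vertices P) (cong b ∘ body-pinned))
                       (trans (any-cong (vertices F) (cong b ∘ body-fresh)) (any-fresh F _)) ⟩
        existsᵃ P (histogram F) (λ P′ h → b ∘ evalᵃ P′ h φ) ρ
          ∎
        where open ≡-Reasoning

      count-body : countTrue (map body (allFin (n G))) ≡ countᵃ P (histogram F) ⟦ φ ⟧ᵃ ρ
      count-body = begin
        countTrue (map body (allFin (n G)))
          ≡⟨ countTrue-map body (allFin (n G)) ⟩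
        countᵇ body (allFin (n G))
          ≡⟨ countᵇ-Decomposition D body ⟩
        countᵇ (body ∘ embed D) (vertices (P ++ F))
          ≡⟨ countᵇ-vertices-++ P F (body ∘ embed D) ⟩
        countᵇ (body ∘ embed D ∘ embedˡ P F) (vertices P) + countᵇ (body ∘ embed D ∘ embedʳ P F) (vertices F)
          ≡⟨ cong₂ _+_ (countᵇ-cong (vertices P) body-pinned)
                       (trans (countᵇ-cong (vertices F) body-fresh) (countᵇ-fresh F _)) ⟩
        countᵃ P (histogram F) ⟦ φ ⟧ᵃ ρ
          ∎
        where open ≡-Reasoning

    eval≡evalᵃ : ∀ {m} (φ : Formula m) → Correct φ
    eval≡evalᵃ (edge x y) P F D ρ = trans (embed-adj D _ _) (embedˡ-adj P F (ρ x) (ρ y))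
    eval≡evalᵃ (eq x y)   P F D ρ =
      ⌊≟⌋-injective _≟ᵛ_ _≟_ (embedˡ-injective P F ∘ embed-injective D) (ρ x) (ρ y)
    eval≡evalᵃ (neg φ)    P F D ρ = cong not (eval≡evalᵃ φ P F D ρ)
    eval≡evalᵃ (and φ ψ)  P F D ρ = cong₂ _∧_ (eval≡evalᵃ φ P F D ρ) (eval≡evalᵃ ψ P F D ρ)
    eval≡evalᵃ (or φ ψ)   P F D ρ = cong₂ _∨_ (eval≡evalᵃ φ P F D ρ) (eval≡evalᵃ ψ P F D ρ)
    eval≡evalᵃ (ex φ)     P F D ρ = Quantifier.any-body φ (eval≡evalᵃ φ) P F D ρ id
    eval≡evalᵃ (all φ)    P F D ρ = cong not (Quantifier.any-body φ (eval≡evalᵃ φ) P F D ρ not)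
    eval≡evalᵃ (exmod j (suc ℓ) _ φ) P F D ρ =
      cong (λ c → (c % suc ℓ) ≡ᵇ j) (Quantifier.count-body φ (eval≡evalᵃ φ) P F D ρ)

-- The component decomposition of a graph in C^c

module Components (c : ℕ) (G : Graph) (small-components : CompsAtMost G c) where

  open Catalogue c
  open DisjointUnion size (λ i → adj (graphAt i))

  component : Fin (n G) → List (Fin (n G))
  component v = filter (reach? G v) (allFin (n G))

  component-unique : ∀ v → Unique (component v)
  component-unique v = UP.filter⁺ (reach? G v) (UP.allFin⁺ _)

  Reach⇒∈component : ∀ {v u} → Reach G v u → u ∈ component v
  Reach⇒∈component {v} {u} vu = ∈-filter⁺ (reach? G v) (∈-allFin u) vu

  componentSize : Fin (n G) → ℕ
  componentSize v = length (component v)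

  member : ∀ v → Fin (componentSize v) → Fin (n G)
  member v = lookup (component v)

  member-reach : ∀ v i → Reach G v (member v i)
  member-reach v i = proj₂ (∈-filter⁻ (reach? G v) {xs = allFin (n G)} (∈-lookup i))

  position : ∀ {v u} → Reach G v u → Fin (componentSize v)
  position vu = index (Reach⇒∈component vu)

  member-position : ∀ {v u} (vu : Reach G v u) → member v (position vu) ≡ u
  member-position vu = lookup-index∈ (Reach⇒∈component vu)

  componentGraph : Fin (n G) → Graph
  componentGraph v = record
    { n      = componentSize v
    ; adj    = λ i j → adj G (member v i) (member v j)
    ; sym    = λ i j → adj-sym G (member v i) (member v j)
    ; irrefl = λ i → irrefl G (member v i)
    }

  componentSize≤c : ∀ v → componentSize v ≤ c
  componentSize≤c v with componentSize v ≤? c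
  ... | yes size≤c = size≤c
  ... | no  size≰c = ⊥-elim (small-components v (member v ∘ (λ i → inject≤ i c<size)) injective (member-reach v ∘ _))
    where
    c<size : c < componentSize v
    c<size = ≰⇒> size≰c
    injective : Injective _≡_ _≡_ (member v ∘ (λ i → inject≤ i c<size))
    injective {i} {j} e = inject≤-injective c<size c<size i j (lookup-injective (component-unique v) e)

  liftWalk : ∀ v {a b} → Reach G a b → (va : Reach G v a) (vb : Reach G v b) →
             Reach (componentGraph v) (position va) (position vb)
  liftWalk v here va vb rewrite lookup-injective (component-unique v)
                                  (trans (member-position va) (sym (member-position vb))) = here
  liftWalk v (step {w = w} ab p) va vb = step ab′ (liftWalk v p vw vb)
    where
    vw : Reach G v w
    vw = Reach-trans G va (step ab here)
    ab′ : adj G (member v (position va)) (member v (position vw)) ≡ true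
    ab′ = trans (cong₂ (adj G) (member-position va) (member-position vw)) ab

  componentGraph-connected : ∀ v → Connected (componentGraph v)
  componentGraph-connected v = position {v} here , λ x y →
    subst₂ (Reach (componentGraph v)) (position-member x) (position-member y)
      (liftWalk v (Reach-trans G (Reach-sym G (member-reach v x)) (member-reach v y)) (member-reach v x) (member-reach v y))
    where
    position-member : ∀ x → position (member-reach v x) ≡ x
    position-member x = lookup-injective (component-unique v) (member-position (member-reach v x))

  componentGraph-MaxDeg≤ : ∀ {d} → MaxDeg≤ G d → ∀ v → MaxDeg≤ (componentGraph v) d
  componentGraph-MaxDeg≤ {d} max-degree v x = begin
    degree (componentGraph v) x                                   ≡⟨ countᵇ-map (adj G (member v x)) (member v) members ⟨
    countᵇ (adj G (member v x)) (map (member v) members)          ≤⟨ countᵇ-Unique-⊆ _ members-unique (λ {u} _ → ∈-allFin u) ⟩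
    degree G (member v x)                                         ≤⟨ max-degree (member v x) ⟩
    d                                                             ∎
    where
    open ≤-Reasoning
    members : List (Fin (componentSize v))
    members = allFin (componentSize v)
    members-unique : Unique (map (member v) members)
    members-unique = UP.map⁺ (lookup-injective (component-unique v)) (UP.allFin⁺ (componentSize v))

  CompIso⇒≅ : ∀ {v} H → CompIso G v H → H ≅ componentGraph v
  CompIso⇒≅ {v} H (f , f-injective , f-reach , f-onto , f-adj) = g , g-injective , g-surjective , g-adj
    where
    g : Fin (n H) → Fin (componentSize v)
    g = position ∘ f-reach
    g-injective : Injective _≡_ _≡_ g
    g-injective {i} {j} gi≡gj = f-injective
      (trans (sym (member-position (f-reach i))) (trans (cong (member v) gi≡gj) (member-position (f-reach j))))
    g-surjective : Surjective _≡_ _≡_ g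
    g-surjective y = let (i , fi≡) = f-onto (member v y) (member-reach v y) in
      i , λ { refl → lookup-injective (component-unique v) (trans (member-position (f-reach i)) fi≡) }
    g-adj : ∀ i j → adj G (member v (g i)) (member v (g j)) ≡ adj H i j
    g-adj i j = trans (cong₂ (adj G) (member-position (f-reach i)) (member-position (f-reach j))) (f-adj i j)

  ≅⇒CompIso : ∀ {v} H → H ≅ componentGraph v → CompIso G v H
  ≅⇒CompIso {v} H (h , h-injective , h-surjective , h-adj) =
    member v ∘ h ,
    h-injective ∘ lookup-injective (component-unique v) ,
    member-reach v ∘ h ,
    (λ u vu → let (i , hi≡) = h-surjective (position vu) in i , trans (cong (member v) (hi≡ refl)) (member-position vu)) ,
    h-adj

  type : Fin (n G) → Fin R
  type v = canonicalIndex (componentGraph v)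

  componentGraph≅ : ∀ v → componentGraph v ≅ graphAt (type v)
  componentGraph≅ v = canonicalIndex-≅ {componentGraph v} (componentSize≤c v)

  block : ∀ v → CompIso G v (graphAt (type v))
  block v = ≅⇒CompIso (graphAt (type v)) (≅-sym {componentGraph v} {graphAt (type v)} (componentGraph≅ v))

  blockEmbedding : ∀ v → Fin (size (type v)) → Fin (n G)
  blockEmbedding v = proj₁ (block v)

  blockEmbedding-injective : ∀ v → Injective _≡_ _≡_ (blockEmbedding v)
  blockEmbedding-injective v = proj₁ (proj₂ (block v))

  blockEmbedding-reach : ∀ v x → Reach G v (blockEmbedding v x)
  blockEmbedding-reach v = proj₁ (proj₂ (proj₂ (block v)))

  blockEmbedding-onto : ∀ v u → Reach G v u → ∃ λ x → blockEmbedding v x ≡ u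
  blockEmbedding-onto v = proj₁ (proj₂ (proj₂ (proj₂ (block v))))

  blockEmbedding-adj : ∀ v x y → adj G (blockEmbedding v x) (blockEmbedding v y) ≡ adj (graphAt (type v)) x y
  blockEmbedding-adj v = proj₂ (proj₂ (proj₂ (proj₂ (block v))))

  CompIso⇔type≡ : ∀ {v} H → n H ≤ c → CompIso G v H ⇔ (type v ≡ canonicalIndex H)
  CompIso⇔type≡ {v} H small = mk⇔
    (λ iso → sym (canonicalIndex-resp-≅ {H} {componentGraph v} (CompIso⇒≅ H iso)))
    (λ type≡ → ≅⇒CompIso H (≅-trans {H} {graphAt (canonicalIndex H)} {componentGraph v}
                 (canonicalIndex-≅ {H} small) (subst (λ i → graphAt i ≅ componentGraph v) type≡ type≅component)))
    where
    type≅component : graphAt (type v) ≅ componentGraph v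
    type≅component = ≅-sym {componentGraph v} {graphAt (type v)} (componentGraph≅ v)

  IsRep? : ∀ v → Dec (IsRep G v)
  IsRep? v = all? λ u → reach? G u v →-dec (toℕ v ≤? toℕ u)

  IsRep-unique : ∀ {r r′ u} → IsRep G r → IsRep G r′ → Reach G r u → Reach G r′ u → r ≡ r′
  IsRep-unique {r} {r′} rep rep′ ru r′u = toℕ-injective (≤-antisym
    (rep r′ (Reach-trans G r′u (Reach-sym G ru))) (rep′ r (Reach-trans G ru (Reach-sym G r′u))))

  representative : ∀ u → ∃ λ r → IsRep G r × Reach G r u
  representative u with least-complete (λ w → reach? G w u) {u} here
  ... | r , least≡r = r , (λ w wr → least-minimal _ least≡r (Reach-trans G wr ru)) , ru
    where
    ru : Reach G r u
    ru = least-sound (λ w → reach? G w u) least≡r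

  roots : List (Fin (n G))
  roots = filter IsRep? (allFin (n G))

  roots-unique : Unique roots
  roots-unique = UP.filter⁺ IsRep? (UP.allFin⁺ _)

  ∈roots⇒IsRep : ∀ {r} → r ∈ roots → IsRep G r
  ∈roots⇒IsRep r∈ = proj₂ (∈-filter⁻ IsRep? {xs = allFin (n G)} r∈)

  blocks : List (Fin R)
  blocks = map type roots

  embedRoots : ∀ rs → Vertex (map type rs) → Fin (n G)
  embedRoots (r ∷ rs) (inj₁ x) = blockEmbedding r x
  embedRoots (r ∷ rs) (inj₂ a) = embedRoots rs a

  rootOf : ∀ rs → Vertex (map type rs) → Fin (n G)
  rootOf (r ∷ rs) (inj₁ x) = r
  rootOf (r ∷ rs) (inj₂ a) = rootOf rs a

  rootOf-∈ : ∀ rs a → rootOf rs a ∈ rs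
  rootOf-∈ (r ∷ rs) (inj₁ x) = here refl
  rootOf-∈ (r ∷ rs) (inj₂ a) = there (rootOf-∈ rs a)

  rootOf-reach : ∀ rs a → Reach G (rootOf rs a) (embedRoots rs a)
  rootOf-reach (r ∷ rs) (inj₁ x) = blockEmbedding-reach r x
  rootOf-reach (r ∷ rs) (inj₂ a) = rootOf-reach rs a

  separated : ∀ {r rs} → Unique (r ∷ rs) → All (IsRep G) (r ∷ rs) →
              ∀ x a → ¬ Reach G (blockEmbedding r x) (embedRoots rs a)
  separated {r} {rs} (r∉rs ∷ _) (rep ∷ reps) x a path =
    All.lookup r∉rs (rootOf-∈ rs a) (IsRep-unique rep (All.lookup reps (rootOf-∈ rs a))
      (Reach-trans G (blockEmbedding-reach r x) path) (rootOf-reach rs a))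

  embedRoots-injective : ∀ {rs} → Unique rs → All (IsRep G) rs → Injective _≡_ _≡_ (embedRoots rs)
  embedRoots-injective {r ∷ rs} u reps {inj₁ x} {inj₁ y} e = cong inj₁ (blockEmbedding-injective r e)
  embedRoots-injective {r ∷ rs} u reps {inj₁ x} {inj₂ b} e = ⊥-elim (separated u reps x b (subst (Reach G _) e here))
  embedRoots-injective {r ∷ rs} u reps {inj₂ a} {inj₁ y} e = ⊥-elim (separated u reps y a (subst (Reach G _) (sym e) here))
  embedRoots-injective {r ∷ rs} (_ ∷ u) (_ ∷ reps) {inj₂ a} {inj₂ b} e = cong inj₂ (embedRoots-injective u reps e)

  embedRoots-adj : ∀ {rs} → Unique rs → All (IsRep G) rs → ∀ a b → adj G (embedRoots rs a) (embedRoots rs b) ≡ adjᵛ a b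
  embedRoots-adj {r ∷ rs} u reps (inj₁ x) (inj₁ y) = blockEmbedding-adj r x y
  embedRoots-adj {r ∷ rs} u reps (inj₁ x) (inj₂ b) = ¬-not λ xb → separated u reps x b (step xb here)
  embedRoots-adj {r ∷ rs} u reps (inj₂ a) (inj₁ y) = ¬-not λ ay → separated u reps y a (step (trans (adj-sym G _ _) ay) here)
  embedRoots-adj {r ∷ rs} (_ ∷ u) (_ ∷ reps) (inj₂ a) (inj₂ b) = embedRoots-adj u reps a b

  embedRoots-onto : ∀ {rs r u} → r ∈ rs → Reach G r u → ∃ λ a → embedRoots rs a ≡ u
  embedRoots-onto {r ∷ rs} (here refl) ru = let (x , e) = blockEmbedding-onto r _ ru in inj₁ x , e
  embedRoots-onto {r ∷ rs} (there r∈) ru = let (a , e) = embedRoots-onto r∈ ru in inj₂ a , e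

  decomposition : Decomposition G blocks
  decomposition = record
    { embed            = embedRoots roots
    ; embed-injective  = embedRoots-injective roots-unique reps
    ; embed-surjective = λ u → let (r , rep , ru) = representative u in
                               embedRoots-onto (∈-filter⁺ IsRep? (∈-allFin r) rep) ru
    ; embed-adj        = embedRoots-adj roots-unique reps
    }
    where
    reps : All (IsRep G) roots
    reps = All.tabulate ∈roots⇒IsRep

  ofType : Fin R → List (Fin (n G))
  ofType i = filter (λ v → i ≟ type v) roots

  histogram-blocks : ∀ i → histogram blocks i ≡ length (ofType i)
  histogram-blocks = histogram-map type roots

  module _ (H : Graph) (small : n H ≤ c) where

    private
      ChvWitness : Fin (n G) → Set
      ChvWitness v = IsRep G v × CompIso G v H

      witness⇒∈ : ∀ {v} → ChvWitness v → v ∈ ofType (canonicalIndex H)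
      witness⇒∈ {v} (rep , iso) = ∈-filter⁺ (λ v → canonicalIndex H ≟ type v) (∈-filter⁺ IsRep? (∈-allFin v) rep)
                                            (sym (Equivalence.to (CompIso⇔type≡ H small) iso))

      ∈⇒witness : ∀ {v} → v ∈ ofType (canonicalIndex H) → ChvWitness v
      ∈⇒witness v∈ = let (v∈roots , index≡type) = ∈-filter⁻ (λ v → canonicalIndex H ≟ type v) {xs = roots} v∈
                     in ∈roots⇒IsRep v∈roots , Equivalence.from (CompIso⇔type≡ H small) (sym index≡type)

      ofType-unique : Unique (ofType (canonicalIndex H))
      ofType-unique = UP.filter⁺ _ roots-unique

    ChvIs⇒≡histogram : ∀ {m} → ChvIs G H m → m ≡ histogram blocks (canonicalIndex H)
    ChvIs⇒≡histogram chv = trans (CountIs⇒≡length ofType-unique witness⇒∈ ∈⇒witness chv)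
                                 (sym (histogram-blocks (canonicalIndex H)))

    ChvIs-histogram : ChvIs G H (histogram blocks (canonicalIndex H))
    ChvIs-histogram = subst (ChvIs G H) (sym (histogram-blocks (canonicalIndex H)))
                            (CountIs-length ofType-unique witness⇒∈ ∈⇒witness)

  type-Realizable : ∀ {d} → MaxDeg≤ G d → ∀ v → Realizable d (type v)
  type-Realizable max-degree v =
    sym (canonicalIndex-resp-≅ {componentGraph v} {graphAt (type v)} (componentGraph≅ v)) ,
    Connected-≅ {componentGraph v} {graphAt (type v)} (componentGraph≅ v) (componentGraph-connected v) ,
    MaxDeg≤-≅ {componentGraph v} {graphAt (type v)} (componentGraph≅ v) (componentGraph-MaxDeg≤ max-degree v)

  histogram-unrealizable : ∀ {d} → MaxDeg≤ G d → ∀ {i} → ¬ Realizable d i → histogram blocks i ≡ 0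
  histogram-unrealizable {d} max-degree {i} unrealizable = trans (histogram-blocks i)
    (cong length (filter-none (λ v → i ≟ type v) {xs = roots} (All.tabulate λ {v} _ i≡type →
      unrealizable (subst (Realizable d) (sym i≡type) (type-Realizable max-degree v)))))

-- Capped histograms

module CappedHistograms (c d : ℕ) (φ : Sentence) where

  open Catalogue c
  open DisjointUnion size (λ i → adj (graphAt i))

  k : ℕ
  k = rank φ

  L : ℕ
  L = period φ

  instance
    L-nonZero : NonZero L
    L-nonZero = period-nonZero φ

  Code : Set
  Code = Fin k ⊎ Fin L

  codes : List Code
  codes = map inj₁ (allFin k) ++ map inj₂ (allFin L)

  codes-complete : ∀ x → x ∈ codes
  codes-complete (inj₁ e) = ∈-++⁺ˡ (∈-map⁺ inj₁ (∈-allFin e))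
  codes-complete (inj₂ j) = ∈-++⁺ʳ (map inj₁ (allFin k)) (∈-map⁺ inj₂ (∈-allFin j))

  decode : Code → Entry
  decode (inj₁ e) = exact (toℕ e)
  decode (inj₂ j) = modc (toℕ j) L (toℕ<n j)

  decode-capped : ∀ x → CappedEntry k (decode x)
  decode-capped (inj₁ e) = toℕ<n e
  decode-capped (inj₂ j) = _

  representativeCount : Code → ℕ
  representativeCount (inj₁ e) = toℕ e
  representativeCount (inj₂ j) = toℕ j + k * L

  EntryOK⇒CountEq : ∀ x {m} → EntryOK k (decode x) m → CountEq k L m (representativeCount x)
  EntryOK⇒CountEq (inj₁ e) e≡m = equal (sym e≡m)
  EntryOK⇒CountEq (inj₂ j) {m} (k≤m , q , m≡j+qL) =
    large k≤m (≤-trans (m≤m*n k L) (m≤n+m (k * L) (toℕ j))) k q (begin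
      m + k * L                   ≡⟨ cong (_+ k * L) m≡j+qL ⟩
      toℕ j + q * L + k * L       ≡⟨ solve 4 (λ j q k L → j :+ q :* L :+ k :* L := j :+ k :* L :+ q :* L)
                                            refl (toℕ j) q k L ⟩
      toℕ j + k * L + q * L       ∎)
    where open ≡-Reasoning

  cap : ℕ → Code
  cap m with m <ℕ? k
  ... | yes m<k = inj₁ (fromℕ< m<k)
  ... | no  _   = inj₂ (fromℕ< (m%n<n m L))

  cap-EntryOK : ∀ m → EntryOK k (decode (cap m)) m
  cap-EntryOK m with m <ℕ? k
  ... | yes m<k = toℕ-fromℕ< m<k
  ... | no  m≮k = ≮⇒≥ m≮k , m / L ,
                  trans (m≡m%n+[m/n]*n m L) (cong (_+ (m / L) * L) (sym (toℕ-fromℕ< (m%n<n m L))))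

  Profile : Set
  Profile = Fin R → Code

  -- Eliminated by gate-elim: a with on realizable? d i would normalise the whole catalogue.
  gate : ∀ {P : Set} → Dec P → ℕ → ℕ
  gate (yes _) x = x
  gate (no  _) x = 0

  gate-elim : ∀ {P : Set} (Q : ℕ → Set) (P? : Dec P) {x} → (P → Q x) → (¬ P → Q 0) → Q (gate P? x)
  gate-elim Q (yes p)  Qx Q0 = Qx p
  gate-elim Q (no ¬p) Qx Q0 = Q0 ¬p

  -- Types that are not the canonical index of a possible component never occur,
  -- whatever the profile says about them.
  profileHistogram : Profile → Histogram
  profileHistogram p i = gate (realizable? d i) (representativeCount (p i))

  accepted : Profile → Bool
  accepted p = evalᵃ [] (profileHistogram p) φ (λ ())

  vector : Profile → CappedVec c d k
  vector p = record
    { entry  = λ H → decode (p (canonicalIndex (graph H)))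
    ; invar  = λ H H′ H≅H′ → cong (decode ∘ p) (canonicalIndex-resp-≅ {graph H} {graph H′} H≅H′)
    ; capped = λ H → decode-capped (p (canonicalIndex (graph H)))
    }

  acceptedProfiles : List Profile
  acceptedProfiles = filter (λ p → accepted p Bool.≟ true) (allFunctions R codes)

  X : List (CappedVec c d k)
  X = map vector acceptedProfiles

  module _ (G : Graph) (G∈class : InClass c d G) where

    open Components c G (proj₂ G∈class)

    max-degree : MaxDeg≤ G d
    max-degree = proj₁ G∈class

    ⊨≡accepted : ∀ p → (∀ i → CountEq k L (histogram blocks i) (profileHistogram p i)) → eval G φ (λ ()) ≡ accepted p
    ⊨≡accepted p blocks≈p = begin
      eval G φ (λ ())                                                 ≡⟨ eval-cong G φ (λ ()) ⟩
      eval G φ (embed decomposition ∘ embedˡ [] blocks ∘ (λ ()))      ≡⟨ eval≡evalᵃ G φ [] blocks decomposition (λ ()) ⟩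
      evalᵃ [] (histogram blocks) φ (λ ())                            ≡⟨ evalᵃ-CountEq φ [] (λ ()) blocks≈p ⟩
      accepted p                                                      ∎
      where open ≡-Reasoning

    module _ (p : Profile) (p≗cap : ∀ i → cap (histogram blocks i) ≡ p i) where

      cap-CountEq : ∀ i → CountEq k L (histogram blocks i) (profileHistogram p i)
      cap-CountEq i = gate-elim (CountEq k L (histogram blocks i)) (realizable? d i)
        (λ _ → subst (CountEq k L (histogram blocks i) ∘ representativeCount) (p≗cap i)
                     (EntryOK⇒CountEq (cap (histogram blocks i)) (cap-EntryOK (histogram blocks i))))
        (equal ∘ histogram-unrealizable max-degree)

      cap-satisfies : SatisfiesVec G (vector p)
      cap-satisfies H m chv = subst₂ (λ x m → EntryOK k (decode x) m) (p≗cap (canonicalIndex (graph H)))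
        (sym (ChvIs⇒≡histogram (graph H) (small H) chv)) (cap-EntryOK (histogram blocks (canonicalIndex (graph H))))

    satisfies⇒CountEq : ∀ p → SatisfiesVec G (vector p) → ∀ i → CountEq k L (histogram blocks i) (profileHistogram p i)
    satisfies⇒CountEq p satisfies i = gate-elim (CountEq k L (histogram blocks i)) (realizable? d i)
      (λ (canonical , connected , bounded) →
        let H : CompGraph c d
            H = record { graph = graphAt i ; connected = connected ; small = size≤c i ; degBound = bounded }
        in subst (λ j → CountEq k L (histogram blocks j) (representativeCount (p j))) canonical
             (EntryOK⇒CountEq (p (canonicalIndex (graphAt i)))
               (satisfies H (histogram blocks (canonicalIndex (graphAt i))) (ChvIs-histogram (graphAt i) (size≤c i)))))
      (equal ∘ histogram-unrealizable max-degree)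

    sound : G ⊨ φ → Any (SatisfiesVec G) X
    sound G⊨φ = lose (∈-map⁺ vector (∈-filter⁺ (λ p → accepted p Bool.≟ true) p∈ p-accepted)) (cap-satisfies p p≗cap)
      where
      capProfile : Profile
      capProfile = cap ∘ histogram blocks
      found : ∃ λ p → p ∈ allFunctions R codes × (∀ i → capProfile i ≡ p i)
      found = find (allFunctions-complete _≡_ R codes capProfile (codes-complete ∘ capProfile))
      p : Profile
      p = proj₁ found
      p∈ : p ∈ allFunctions R codes
      p∈ = proj₁ (proj₂ found)
      p≗cap : ∀ i → capProfile i ≡ p i
      p≗cap = proj₂ (proj₂ found)
      p-accepted : accepted p ≡ true
      p-accepted = trans (sym (⊨≡accepted p (cap-CountEq p p≗cap))) G⊨φ

    complete : Any (SatisfiesVec G) X → G ⊨ φ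
    complete satisfied =
      let (v , v∈X , satisfies) = find satisfied
          (p , p∈ , v≡vector-p) = ∈-map⁻ vector v∈X
      in trans (⊨≡accepted p (satisfies⇒CountEq p (subst (SatisfiesVec G) v≡vector-p satisfies)))
               (proj₂ (∈-filter⁻ (λ p → accepted p Bool.≟ true) {xs = allFunctions R codes} p∈))

lemma3p5 : (c d : ℕ) → 1 ≤ c → (φ : Sentence) → Satisfiable φ →
    ∃ λ (k : ℕ) → Σ (List (CappedVec c d k)) λ X →
      ∀ (G : Graph) → InClass c d G →
        ((G ⊨ φ → Any (SatisfiesVec G) X) × (Any (SatisfiesVec G) X → G ⊨ φ))
lemma3p5 c d _ φ _ = k , X , λ G inClass → sound G inClass , complete G inClass
  where open CappedHistograms c d φ
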